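{- Let $h>k$ be relatively prime squarefree positive integers, $m=hk^2$, $\widehat m=h^2k$, let $\alpha$ be the real cube root of $m$ and $\widehat\alpha$ the real cube root of $\widehat m$, and $K=\mathbb{Q}(\alpha)$. Let $\sigma=3$ if $m\equiv\pm1\pmod 9$ and $\sigma=1$ otherwise; let $\pm$ denote $-$ if $m\equiv-1\pmod 9$ and $+$ otherwise, and $\mp$ the opposite sign. Let $\theta=\frac1\sigma(k\pm k\alpha+\widehat\alpha)$, so that $\mathcal{O}_K=\mathbb{Z}\oplus\alpha\mathbb{Z}\oplus\theta\mathbb{Z}$. Put $p=\frac1\sigma(hk\mp k^3)$, $q=\frac1\sigma(k-k^3)$, $r=\frac1{\sigma^2}(k^2\mp2h+1)$, $s=\frac1{\sigma^2}(h\mp k^4)$, $t=\frac1\sigma(k^3+2k)$ (these are integers). Let $M=a\mathbb{Z}+(b+c\alpha)\mathbb{Z}+(d+e\alpha+f\theta)\mathbb{Z}$ be a $\mathbb{Z}$-submodule of $\mathcal{O}_K$ given in canonical form, i.e. with integers $a,c,f>0$, $0\le b<a$, $0\le d<a$, $0\le e<c$. Then $M$ is an ideal of $\mathcal{O}_K$ if and only if all of the following divisibility conditions hold: (1a) $c\mid a$; (1b) $c\mid b$; (2a) $f\mid a$; (2b) $f\mid \sigma kc$; (2c) $f\mid\sigma ke$; (2d) $f\mid b\pm k^2c$; (2e) $f\mid d\pm k^2e$; (3a) $cf\mid ae$; (3b) $cf\mid be-cd$; (3c) $cf\mid be\pm k^2ce$; (3d) $cf\mid df+qf^2-\sigma ke^2\mp2k^2ef$;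 (3e) $cf\mid qef+sf^2-de-tef\mp k^2e^2$; (4a) $acf\mid (k^2c^2+b^2)f\mp k^2bcf-\sigma kc(be-cd)$; (4b) $acf\mid (pc-qb)cf+(b\pm k^2c)(be-cd)$; (4c) $acf\mid (pcf-k^2ce-bd-qbf)f\pm k^2f(2be-cd)+\sigma ke(be-cd)$; (4d) $acf\mid (pce-rk^2cf-qbe-sbf)f+(d+tf\pm k^2e)(be-cd)$.
   Context: Every full-rank $\mathbb{Z}$-submodule of $\mathcal{O}_K=\mathbb{Z}\oplus\alpha\mathbb{Z}\oplus\theta\mathbb{Z}$ can be written uniquely as $a\mathbb{Z}+(b+c\alpha)\mathbb{Z}+(d+e\alpha+f\theta)\mathbb{Z}$ with integers $a,c,f>0$, $0\le b<a$, $0\le d<a$, $0\le e<c$; this is called its canonical form. -}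

module Defs where

open import Data.Nat as N using (ℕ; zero; suc; NonZero; _%_)
open import Data.Nat.Divisibility as ℕD using ()
open import Data.Integer as Z using (ℤ; +_; -_; _/ℕ_)
open import Data.Integer.Divisibility as ℤD using (_∣_)
open import Data.Rational as ℚ using (ℚ)
open import Data.Product using (Σ; ∃; _×_; _,_)
open import Relation.Binary.PropositionalEquality using (_≡_)

SquareFree : ℕ → Set
SquareFree n = ∀ d → (d N.* d) ℕD.∣ n → d ≡ 1

mN : ℕ → ℕ → ℕ
mN h k = h N.* k N.* k

-- σ = 3 if m ≡ ±1 (mod 9), σ = 1 otherwise; written as suc σ-1 so it is
-- visibly nonzero.
σ-1 : ℕ → ℕ → ℕ
σ-1 h k with mN h k % 9
... | 1 = 2
... | 8 = 2
... | _ = 0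

σ : ℕ → ℕ → ℕ
σ h k = suc (σ-1 h k)

-- ε is the sign "±": -1 if m ≡ -1 (mod 9), +1 otherwise ("∓" is -ε).
ε : ℕ → ℕ → ℤ
ε h k with mN h k % 9
... | 8 = - (+ 1)
... | _ = + 1

σℤ : ℕ → ℕ → ℤ
σℤ h k = + σ h k

-- Integer parameters p q r s t (exact divisions by σ resp. σ²).
pZ qZ rZ sZ tZ : ℕ → ℕ → ℤ
pZ h k = ((+ h) Z.* (+ k) Z.- ε h k Z.* (+ k) Z.^ 3) /ℕ σ h k
qZ h k = ((+ k) Z.- (+ k) Z.^ 3) /ℕ σ h k
rZ h k = ((+ k) Z.^ 2 Z.- ε h k Z.* (+ 2) Z.* (+ h) Z.+ + 1) /ℕ (σ h k N.* σ h k)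
sZ h k = ((+ h) Z.- ε h k Z.* (+ k) Z.^ 4) /ℕ (σ h k N.* σ h k)
tZ h k = ((+ k) Z.^ 3 Z.+ (+ 2) Z.* (+ k)) /ℕ σ h k

-- The field K = ℚ(α) ≅ ℚ[x]/(x³ - m), elements written in the basis 1, α, α².

record K : Set where
  constructor ⟨_,_,_⟩
  field
    c0 c1 c2 : ℚ

open K public

ι : ℤ → ℚ
ι z = z ℚ./ 1

_+K_ : K → K → K
⟨ a0 , a1 , a2 ⟩ +K ⟨ b0 , b1 , b2 ⟩ = ⟨ a0 ℚ.+ b0 , a1 ℚ.+ b1 , a2 ℚ.+ b2 ⟩

-- multiplication in K, using α³ = m
mulK : ℕ → ℕ → K → K → K
mulK h k ⟨ a0 , a1 , a2 ⟩ ⟨ b0 , b1 , b2 ⟩ =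
  let m = ι (+ mN h k) in
  ⟨ a0 ℚ.* b0 ℚ.+ m ℚ.* (a1 ℚ.* b2 ℚ.+ a2 ℚ.* b1)
  , a0 ℚ.* b1 ℚ.+ a1 ℚ.* b0 ℚ.+ m ℚ.* (a2 ℚ.* b2)
  , a0 ℚ.* b2 ℚ.+ a1 ℚ.* b1 ℚ.+ a2 ℚ.* b0 ⟩

_·K_ : ℤ → K → K
z ·K ⟨ a0 , a1 , a2 ⟩ = ⟨ ι z ℚ.* a0 , ι z ℚ.* a1 , ι z ℚ.* a2 ⟩

0K 1K αK : K
0K = ⟨ ι (+ 0) , ι (+ 0) , ι (+ 0) ⟩
1K = ⟨ ι (+ 1) , ι (+ 0) , ι (+ 0) ⟩
αK = ⟨ ι (+ 0) , ι (+ 1) , ι (+ 0) ⟩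

-- θ = (k ± kα + α̂)/σ where α̂ = ∛(h²k) = α²/k
θK : (h k : ℕ) → .{{NonZero k}} → K
θK h k = ⟨ (+ k) ℚ./ σ h k
         , (ε h k Z.* + k) ℚ./ σ h k
         , ((+ 1) ℚ./ σ h k) ℚ.* ((+ 1) ℚ./ k) ⟩

Span : K → K → K → K → Set
Span g1 g2 g3 x = Σ ℤ λ u → Σ ℤ λ v → Σ ℤ λ w →
  x ≡ ((u ·K g1) +K (v ·K g2)) +K (w ·K g3)

OK : (h k : ℕ) → .{{NonZero k}} → K → Set
OK h k = Span 1K αK (θK h k)

Mod : (h k : ℕ) → .{{NonZero k}} → (a b c d e f : ℤ) → K → Set
Mod h k a b c d e f =
  Span (a ·K 1K) ((b ·K 1K) +K (c ·K αK))
       (((d ·K 1K) +K (e ·K αK)) +K (f ·K θK h k))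

IsIdeal : (h k : ℕ) → .{{NonZero k}} → (K → Set) → Set
IsIdeal h k P =
  (∀ x → P x → OK h k x) ×
  P 0K ×
  (∀ x y → P x → P y → P (x +K y)) ×
  (∀ ω x → OK h k ω → P x → P (mulK h k ω x))

-- The divisibility conditions (1a)–(4d); "±x" is ε·x and "∓x" is -ε·x.

Conditions : (h k : ℕ) → (a b c d e f : ℤ) → Set
Conditions h k a b c d e f =
  let open Z using (_+_; _-_; _*_; _^_)
      s = σℤ h k; pm = ε h k; K = + k
      p = pZ h k; q = qZ h k; r = rZ h k; sv = sZ h k; t = tZ h k
      cf = c * f; acf = a * c * f
      X = b * e - c * d
  in
  (c ∣ a) × (c ∣ b) ×
  (f ∣ a) × (f ∣ s * K * c) × (f ∣ s * K * e) ×
  (f ∣ b + pm * K ^ 2 * c) × (f ∣ d + pm * K ^ 2 * e) ×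
  (cf ∣ a * e) × (cf ∣ X) × (cf ∣ b * e + pm * K ^ 2 * c * e) ×
  (cf ∣ d * f + q * f ^ 2 - s * K * e ^ 2 - pm * (+ 2) * K ^ 2 * e * f) ×
  (cf ∣ q * e * f + sv * f ^ 2 - d * e - t * e * f - pm * K ^ 2 * e ^ 2) ×
  (acf ∣ (K ^ 2 * c ^ 2 + b ^ 2) * f - pm * K ^ 2 * b * c * f - s * K * c * X) ×
  (acf ∣ (p * c - q * b) * c * f + (b + pm * K ^ 2 * c) * X) ×
  (acf ∣ (p * c * f - K ^ 2 * c * e - b * d - q * b * f) * f
          + pm * K ^ 2 * f * ((+ 2) * b * e - c * d) + s * K * e * X) ×
  (acf ∣ (p * c * e - r * K ^ 2 * c * f - q * b * e - sv * b * f) * f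
          + (d + t * f + pm * K ^ 2 * e) * X)

-- Identify u + vα + wθ ∈ 𝒪_K with its coordinate vector (u, v, w) ∈ ℤ³. Then M is the lattice
-- spanned by the columns g₁ = (a, 0, 0), g₂ = (b, c, 0), g₃ = (d, e, f) of a triangular matrix,
-- and multiplication by α and by θ are the integer matrices whose columns are the coordinates of
-- α·1, α², αθ and θ·1, θα, θ²: α² = -k² ∓ k²α + σkθ, αθ = p + qα ± k²θ and θ² = -k²r + sα + tθ.
-- Writing ε for the sign ±, these coefficients are integers because m ≡ ±1 (mod 9) forces k ≡ δ
-- (mod 3) and h ≡ δεk (mod 9) for some δ = ±1. An additive subgroup of 𝒪_K is an ideal exactly
-- when it is stable under multiplication by α and θ, i.e. when the six vectors α·gᵢ, θ·gᵢ lie in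
-- the lattice. Membership of (U, V, W) in the triangular lattice is decided by successive
-- division: f ∣ W, cf ∣ Vf - We and acf ∣ Ucf - (Vf - We)b - Wcd. Expanding these eighteen
-- divisibilities for the six products gives conditions (1a)-(4d); the one for the middle
-- coordinate of α·g₂ follows from (1b) and (2c).

module Submission where

open import Algebra.Properties.Group using (∙-cancelʳ)
open import Data.Empty using (⊥; ⊥-elim)
open import Data.Integer as Z using (ℤ; +_; -[1+_]; _/ℕ_; _%ℕ_)
open import Data.Integer.Divisibility using () renaming (_∣_ to _∣ᵤ_)
open import Data.Integer.Divisibility.Signed as ℤS using (_∣_; divides; ∣⇒∣ᵤ; ∣ᵤ⇒∣)
import Data.Integer.DivMod as ℤD
import Data.Integer.Properties as ℤP
import Data.Integer.Tactic.RingSolver as ℤRing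
open import Data.Nat as N using (ℕ; suc; NonZero; _%_; _/_)
open import Data.Nat.Coprimality using (Coprime)
import Data.Nat.DivMod as ℕD
import Data.Nat.Properties as ℕP
import Data.Nat.Tactic.RingSolver as ℕRing
open import Data.Product using (Σ; ∃; _×_; _,_; proj₁; proj₂)
open import Data.Rational as Q using (ℚ; 0ℚ; 1ℚ)
import Data.Rational.Properties as ℚP
import Data.Rational.Unnormalised as ℚᵘ
import Data.Rational.Unnormalised.Properties as ℚᵘP
open import Data.Sum using (_⊎_; inj₁; inj₂)
open import Function.Bundles using (_⇔_; mk⇔; Equivalence)
open import Function.Construct.Composition using (_⇔-∘_)
open import Relation.Binary.PropositionalEquality
open import Relation.Nullary.Decidable.Core using (dec⇒maybe)
import Tactic.RingSolver as Ring
import Tactic.RingSolver.Core.AlmostCommutativeRing as ACR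

open import Defs

+-cancelʳ : ∀ x y z → y Q.+ x ≡ z Q.+ x → y ≡ z
+-cancelʳ = ∙-cancelʳ ℚP.+-0-group

ℚ-ring : ACR.AlmostCommutativeRing _ _
ℚ-ring = ACR.fromCommutativeRing ℚP.+-*-commutativeRing λ x → dec⇒maybe (0ℚ ℚP.≟ x)

cong₃ : ∀ {A B C D : Set} (f : A → B → C → D) {x y z x′ y′ z′} →
        x ≡ x′ → y ≡ y′ → z ≡ z′ → f x y z ≡ f x′ y′ z′
cong₃ f refl refl refl = refl

multiple-of-suc-below : ∀ z r d → + r ≡ z Z.* + suc d → r N.< suc d → z ≡ + 0
multiple-of-suc-below (+ 0)     r d _  _ = refl
multiple-of-suc-below (+ suc n) r d eq r<d =
  ⊥-elim (ℕP.<⇒≱ r<d (subst (suc d N.≤_) (sym (ℤP.+-injective eq)) (ℕP.m≤m+n (suc d) _)))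
multiple-of-suc-below -[1+ n ]  r d () _

/ℕ-exact : ∀ x d .{{_ : NonZero d}} → + d ∣ x → + d Z.* (x /ℕ d) ≡ x
/ℕ-exact x (suc d) (divides y x≡y*d) = begin
  + suc d * q  ≡⟨ ℤP.*-comm (+ suc d) q ⟩
  q * + suc d  ≡⟨ cong (_* + suc d) (sym y≡q) ⟩
  y * + suc d  ≡⟨ x≡y*d ⟨
  x            ∎
  where
  open ≡-Reasoning
  open Z using (_+_; _-_; _*_)
  q : ℤ
  q = x /ℕ suc d
  remainder≡ : + (x %ℕ suc d) ≡ (y - q) * + suc d
  remainder≡ = begin
    + (x %ℕ suc d)                              ≡⟨ add-sub (+ (x %ℕ suc d)) (q * + suc d) ⟩
    + (x %ℕ suc d) + q * + suc d - q * + suc d  ≡⟨ cong (_- q * + suc d) (ℤD.a≡a%ℕn+[a/ℕn]*n x (suc d)) ⟨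
    x - q * + suc d                             ≡⟨ cong (_- q * + suc d) x≡y*d ⟩
    y * + suc d - q * + suc d                   ≡⟨ sub-mul y q (+ suc d) ⟩
    (y - q) * + suc d                           ∎
    where
    add-sub : ∀ u v → u ≡ u + v - v
    add-sub = ℤRing.solve-∀
    sub-mul : ∀ u v w → u * w - v * w ≡ (u - v) * w
    sub-mul = ℤRing.solve-∀
  y≡q : y ≡ q
  y≡q = ℤP.i-j≡0⇒i≡j y q (multiple-of-suc-below (y - q) _ d remainder≡ (ℤD.n%ℕd<d x (suc d)))

≡-modulo : ∀ {u v} → u ≡ v → ∀ {x} y c → x ≡ y Z.+ c Z.* (u Z.- v) → x ≡ y
≡-modulo {u} refl y c x≡ = trans x≡ (ring y c u)
  where
  ring : ∀ y c u → y Z.+ c Z.* (u Z.- u) ≡ y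
  ring = ℤRing.solve-∀

pNumerator rNumerator sNumerator : ℤ → ℤ → ℤ → ℤ
pNumerator h k ε = h Z.* k Z.- ε Z.* k Z.^ 3
rNumerator h k ε = k Z.^ 2 Z.- ε Z.* + 2 Z.* h Z.+ + 1
sNumerator h k ε = h Z.- ε Z.* k Z.^ 4

qNumerator tNumerator : ℤ → ℤ
qNumerator k = k Z.- k Z.^ 3
tNumerator k = k Z.^ 3 Z.+ + 2 Z.* k

-- Once k = δ + 3D with δ = ±1, the congruence hk² ≡ ε (mod 9) forces h = δεk + 9H, and the
-- numerators of p, q, r, s, t become explicit multiples of 3 or 9.
module _ (ε δ D : ℤ) (ε²≡1 : ε Z.* ε ≡ + 1) (δ²≡1 : δ Z.* δ ≡ + 1) where
  open Z using (_+_; _-_; _*_; -_)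

  private
    k : ℤ
    k = δ + + 3 * D

  h≡δεk+9H : ∀ h J → h * k * k ≡ + 9 * J + ε → ∃ λ H → h ≡ δ * ε * k + + 9 * H
  h≡δεk+9H h J m≡ = δ * (J * k - h * B) ,
    ≡-modulo δ²≡1 _ (- (h * (+ 1 + δ * δ + + 9 * δ * D))) (≡-modulo m≡ _ (δ * k) (ring h J ε δ D))
    where
    B : ℤ
    B = D + + 3 * δ * D * D + + 3 * D * D * D
    ring : ∀ h J ε δ D → h ≡ δ * ε * (δ + + 3 * D)
        + + 9 * (δ * (J * (δ + + 3 * D) - h * (D + + 3 * δ * D * D + + 3 * D * D * D)))
        + - (h * (+ 1 + δ * δ + + 9 * δ * D)) * (δ * δ - + 1)
        + δ * (δ + + 3 * D) * (h * (δ + + 3 * D) * (δ + + 3 * D) - (+ 9 * J + ε))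
    ring = ℤRing.solve-∀

  module _ (H : ℤ) where
    private
      h : ℤ
      h = δ * ε * k + + 9 * H

    3∣pNumerator : + 3 ∣ pNumerator h k ε
    3∣pNumerator = divides (- (ε * k * k * D) + + 3 * H * k) (ring ε δ D H)
      where
      ring : ∀ ε δ D H →
        (δ * ε * (δ + + 3 * D) + + 9 * H) * (δ + + 3 * D)
          - ε * ((δ + + 3 * D) * ((δ + + 3 * D) * ((δ + + 3 * D) * + 1)))
        ≡ (- (ε * (δ + + 3 * D) * (δ + + 3 * D) * D) + + 3 * H * (δ + + 3 * D)) * + 3
      ring = ℤRing.solve-∀

    3∣qNumerator : + 3 ∣ qNumerator k
    3∣qNumerator = divides (- (k * D * (+ 2 * δ + + 3 * D))) (≡-modulo δ²≡1 _ (- k) (ring δ D))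
      where
      ring : ∀ δ D → (δ + + 3 * D) - (δ + + 3 * D) * ((δ + + 3 * D) * ((δ + + 3 * D) * + 1))
        ≡ - ((δ + + 3 * D) * D * (+ 2 * δ + + 3 * D)) * + 3 + - (δ + + 3 * D) * (δ * δ - + 1)
      ring = ℤRing.solve-∀

    9∣rNumerator : + 9 ∣ rNumerator h k ε
    9∣rNumerator = divides (D * D - + 2 * ε * H)
      (≡-modulo ε²≡1 _ (- (+ 2 * δ * k)) (≡-modulo δ²≡1 _ (- + 1) (ring ε δ D H)))
      where
      ring : ∀ ε δ D H →
        (δ + + 3 * D) * ((δ + + 3 * D) * + 1) - ε * + 2 * (δ * ε * (δ + + 3 * D) + + 9 * H) + + 1
        ≡ (D * D - + 2 * ε * H) * + 9 + - (+ 2 * δ * (δ + + 3 * D)) * (ε * ε - + 1)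
          + - + 1 * (δ * δ - + 1)
      ring = ℤRing.solve-∀

    9∣sNumerator : + 9 ∣ sNumerator h k ε
    9∣sNumerator = divides (H - ε * k * (D + + 3 * δ * D * D + + 3 * D * D * D))
      (≡-modulo δ²≡1 _ (- (ε * k * (δ + + 9 * D))) (ring ε δ D H))
      where
      ring : ∀ ε δ D H → δ * ε * (δ + + 3 * D) + + 9 * H
          - ε * ((δ + + 3 * D) * ((δ + + 3 * D) * ((δ + + 3 * D) * ((δ + + 3 * D) * + 1))))
        ≡ (H - ε * (δ + + 3 * D) * (D + + 3 * δ * D * D + + 3 * D * D * D)) * + 9
          + - (ε * (δ + + 3 * D) * (δ + + 9 * D)) * (δ * δ - + 1)
      ring = ℤRing.solve-∀

    3∣tNumerator : + 3 ∣ tNumerator k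
    3∣tNumerator = divides (k + k * D * (+ 2 * δ + + 3 * D)) (≡-modulo δ²≡1 _ k (ring δ D))
      where
      ring : ∀ δ D → (δ + + 3 * D) * ((δ + + 3 * D) * ((δ + + 3 * D) * + 1)) + + 2 * (δ + + 3 * D)
        ≡ ((δ + + 3 * D) + (δ + + 3 * D) * D * (+ 2 * δ + + 3 * D)) * + 3
          + (δ + + 3 * D) * (δ * δ - + 1)
      ring = ℤRing.solve-∀

numerators-divisible : ∀ {h k ε} δ D J → ε Z.* ε ≡ + 1 → δ Z.* δ ≡ + 1 →
  k ≡ δ Z.+ + 3 Z.* D → h Z.* k Z.* k ≡ + 9 Z.* J Z.+ ε →
  + 3 ∣ pNumerator h k ε × + 3 ∣ qNumerator k × + 9 ∣ rNumerator h k ε × + 9 ∣ sNumerator h k ε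
    × + 3 ∣ tNumerator k
numerators-divisible {h} {ε = ε} δ D J ε²≡1 δ²≡1 refl m≡
  with h≡δεk+9H ε δ D ε²≡1 δ²≡1 h J m≡
... | H , refl =
  3∣pNumerator ε δ D ε²≡1 δ²≡1 H , 3∣qNumerator ε δ D ε²≡1 δ²≡1 H , 9∣rNumerator ε δ D ε²≡1 δ²≡1 H ,
  9∣sNumerator ε δ D ε²≡1 δ²≡1 H , 3∣tNumerator ε δ D ε²≡1 δ²≡1 H

-- σ and ε are defined by matching on mN h k % 9, so every residue is matched literally.
σ-ε-cases : ∀ h k → (σ h k ≡ 1 × ε h k ≡ + 1)
  ⊎ (mN h k % 9 ≡ 1 × σ h k ≡ 3 × ε h k ≡ + 1)
  ⊎ (mN h k % 9 ≡ 8 × σ h k ≡ 3 × ε h k ≡ Z.- + 1)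
σ-ε-cases h k with mN h k % 9
... | 0 = inj₁ (refl , refl)
... | 1 = inj₂ (inj₁ (refl , refl , refl))
... | 2 = inj₁ (refl , refl)
... | 3 = inj₁ (refl , refl)
... | 4 = inj₁ (refl , refl)
... | 5 = inj₁ (refl , refl)
... | 6 = inj₁ (refl , refl)
... | 7 = inj₁ (refl , refl)
... | 8 = inj₂ (inj₂ (refl , refl , refl))
... | suc (suc (suc (suc (suc (suc (suc (suc (suc _)))))))) = inj₁ (refl , refl)

+mN : ∀ h k → + mN h k ≡ + h Z.* + k Z.* + k
+mN h k = trans (ℤP.pos-* (h N.* k) k) (cong (Z._* + k) (ℤP.pos-* h k))

+[r+a*n] : ∀ r a n → + (r N.+ a N.* n) ≡ + r Z.+ + n Z.* + a
+[r+a*n] r a n =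
  trans (ℤP.pos-+ r (a N.* n)) (cong (Z._+_ (+ r)) (trans (ℤP.pos-* a n) (ℤP.*-comm (+ a) (+ n))))

mN-division : ∀ h k → + h Z.* + k Z.* + k ≡ + (mN h k % 9) Z.+ + 9 Z.* + (mN h k / 9)
mN-division h k =
  trans (sym (+mN h k)) (trans (cong +_ (ℕD.m≡m%n+[m/n]*n (mN h k) 9)) (+[r+a*n] _ (mN h k / 9) 9))

k≡δ+3D : ∀ h k → mN h k % 9 ≡ 1 ⊎ mN h k % 9 ≡ 8 →
  Σ ℤ λ δ → Σ ℤ λ D → δ Z.* δ ≡ + 1 × + k ≡ δ Z.+ + 3 Z.* D
k≡δ+3D h k m≡±1 with k % 3 | ℕD.m≡m%n+[m/n]*n k 3 | ℕD.m%n<n k 3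
... | 0 | k≡ | _ = ⊥-elim (m%9≢0 m≡±1)
  where
  m%9≡0 : mN h k % 9 ≡ 0
  m%9≡0 = trans (cong (λ x → h N.* x N.* x % 9) k≡)
    (trans (cong (_% 9) (ring h (k / 3))) (ℕD.m*n%n≡0 (h N.* (k / 3) N.* (k / 3)) 9))
    where
    ring : ∀ h a → h N.* (0 N.+ a N.* 3) N.* (0 N.+ a N.* 3) ≡ h N.* a N.* a N.* 9
    ring = ℕRing.solve-∀
  m%9≢0 : mN h k % 9 ≡ 1 ⊎ mN h k % 9 ≡ 8 → ⊥
  m%9≢0 (inj₁ m≡1) with () ← trans (sym m%9≡0) m≡1
  m%9≢0 (inj₂ m≡8) with () ← trans (sym m%9≡0) m≡8
... | 1 | k≡ | _ = + 1 , + (k / 3) , refl , trans (cong +_ k≡) (+[r+a*n] 1 (k / 3) 3)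
... | 2 | k≡ | _ = Z.- + 1 , + (k / 3) Z.+ + 1 , refl ,
  trans (cong +_ k≡) (trans (+[r+a*n] 2 (k / 3) 3) (ring (+ (k / 3))))
  where
  ring : ∀ a → + 2 Z.+ + 3 Z.* a ≡ Z.- + 1 Z.+ + 3 Z.* (a Z.+ + 1)
  ring = ℤRing.solve-∀
... | suc (suc (suc _)) | _ | N.s≤s (N.s≤s (N.s≤s ()))

record Integrality (h k : ℕ) : Set where
  field
    ε²≡1 : ε h k Z.* ε h k ≡ + 1
    σ∣p : + σ h k ∣ pNumerator (+ h) (+ k) (ε h k)
    σ∣q : + σ h k ∣ qNumerator (+ k)
    σ²∣r : + (σ h k N.* σ h k) ∣ rNumerator (+ h) (+ k) (ε h k)
    σ²∣s : + (σ h k N.* σ h k) ∣ sNumerator (+ h) (+ k) (ε h k)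
    σ∣t : + σ h k ∣ tNumerator (+ k)

integrality-σ≡1 : ∀ h k → σ h k ≡ 1 → ε h k ≡ + 1 → Integrality h k
integrality-σ≡1 h k σ≡1 ε≡1 = record
  { ε²≡1 = cong (λ x → x Z.* x) ε≡1
  ; σ∣p = σ∣ _ ; σ∣q = σ∣ _ ; σ²∣r = σ²∣ _ ; σ²∣s = σ²∣ _ ; σ∣t = σ∣ _
  }
  where
  1∣ : ∀ x → + 1 ∣ x
  1∣ x = divides x (sym (ℤP.*-identityʳ x))
  σ∣ : ∀ x → + σ h k ∣ x
  σ∣ x = subst (λ s → + s ∣ x) (sym σ≡1) (1∣ x)
  σ²∣ : ∀ x → + (σ h k N.* σ h k) ∣ x
  σ²∣ x = subst (λ s → + (s N.* s) ∣ x) (sym σ≡1) (1∣ x)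

integrality-σ≡3 : ∀ h k → σ h k ≡ 3 → ε h k Z.* ε h k ≡ + 1 →
  ∀ J → + h Z.* + k Z.* + k ≡ + 9 Z.* J Z.+ ε h k →
  (Σ ℤ λ δ → Σ ℤ λ D → δ Z.* δ ≡ + 1 × + k ≡ δ Z.+ + 3 Z.* D) → Integrality h k
integrality-σ≡3 h k σ≡3 ε²≡1 J m≡ (δ , D , δ²≡1 , k≡)
  with numerators-divisible δ D J ε²≡1 δ²≡1 k≡ m≡
... | 3∣p , 3∣q , 9∣r , 9∣s , 3∣t = record
  { ε²≡1 = ε²≡1 ; σ∣p = σ∣ 3∣p ; σ∣q = σ∣ 3∣q ; σ²∣r = σ²∣ 9∣r ; σ²∣s = σ²∣ 9∣s ; σ∣t = σ∣ 3∣t }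
  where
  σ∣ : ∀ {x} → + 3 ∣ x → + σ h k ∣ x
  σ∣ {x} = subst (λ s → + s ∣ x) (sym σ≡3)
  σ²∣ : ∀ {x} → + 9 ∣ x → + (σ h k N.* σ h k) ∣ x
  σ²∣ {x} = subst (λ s → + (s N.* s) ∣ x) (sym σ≡3)

integrality : ∀ h k → Integrality h k
integrality h k with σ-ε-cases h k
... | inj₁ (σ≡1 , ε≡1) = integrality-σ≡1 h k σ≡1 ε≡1
... | inj₂ (inj₁ (m%9≡1 , σ≡3 , ε≡1)) =
  integrality-σ≡3 h k σ≡3 (cong (λ x → x Z.* x) ε≡1) (+ q) m≡ (k≡δ+3D h k (inj₁ m%9≡1))
  where
  q : ℕ
  q = mN h k / 9
  m≡ : + h Z.* + k Z.* + k ≡ + 9 Z.* + q Z.+ ε h k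
  m≡ = trans (mN-division h k) (trans (cong (λ r → + r Z.+ + 9 Z.* + q) m%9≡1)
         (trans (ℤP.+-comm (+ 1) (+ 9 Z.* + q)) (cong (Z._+_ (+ 9 Z.* + q)) (sym ε≡1))))
... | inj₂ (inj₂ (m%9≡8 , σ≡3 , ε≡-1)) =
  integrality-σ≡3 h k σ≡3 (cong (λ x → x Z.* x) ε≡-1) (+ q Z.+ + 1) m≡ (k≡δ+3D h k (inj₂ m%9≡8))
  where
  q : ℕ
  q = mN h k / 9
  m≡ : + h Z.* + k Z.* + k ≡ + 9 Z.* (+ q Z.+ + 1) Z.+ ε h k
  m≡ = trans (mN-division h k) (trans (cong (λ r → + r Z.+ + 9 Z.* + q) m%9≡8)
         (trans (ring (+ q)) (cong (Z._+_ (+ 9 Z.* (+ q Z.+ + 1))) (sym ε≡-1))))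
    where
    ring : ∀ q → + 8 Z.+ + 9 Z.* q ≡ + 9 Z.* (q Z.+ + 1) Z.+ Z.- + 1
    ring = ℤRing.solve-∀

ι≃ : ∀ x → Q.toℚᵘ (ι x) ℚᵘ.≃ ℚᵘ.mkℚᵘ x 0
ι≃ x = ℚP.toℚᵘ-fromℚᵘ (ℚᵘ.mkℚᵘ x 0)

ι-from-≃ : ∀ x p → ℚᵘ.mkℚᵘ x 0 ℚᵘ.≃ Q.toℚᵘ p → ι x ≡ p
ι-from-≃ x p eq = trans (ℚP.fromℚᵘ-cong eq) (ℚP.fromℚᵘ-toℚᵘ p)

ι-+ : ∀ x y → ι (x Z.+ y) ≡ ι x Q.+ ι y
ι-+ x y = ι-from-≃ (x Z.+ y) (ι x Q.+ ι y) (ℚᵘP.≃-trans (ℚᵘ.*≡* (ring x y))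
  (ℚᵘP.≃-sym (ℚᵘP.≃-trans (ℚP.toℚᵘ-homo-+ (ι x) (ι y)) (ℚᵘP.+-cong (ι≃ x) (ι≃ y)))))
  where
  ring : ∀ x y → (x Z.+ y) Z.* + 1 ≡ (x Z.* + 1 Z.+ y Z.* + 1) Z.* + 1
  ring = ℤRing.solve-∀

ι-* : ∀ x y → ι (x Z.* y) ≡ ι x Q.* ι y
ι-* x y = ι-from-≃ (x Z.* y) (ι x Q.* ι y) (ℚᵘP.≃-trans (ℚᵘ.*≡* refl)
  (ℚᵘP.≃-sym (ℚᵘP.≃-trans (ℚP.toℚᵘ-homo-* (ι x) (ι y)) (ℚᵘP.*-cong (ι≃ x) (ι≃ y)))))

ι-neg : ∀ x → ι (Z.- x) ≡ Q.- ι x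
ι-neg x = ι-from-≃ (Z.- x) (Q.- ι x)
  (ℚᵘP.≃-sym (ℚᵘP.≃-trans (ℚP.toℚᵘ-homo‿- (ι x)) (ℚᵘP.-‿cong (ι≃ x))))

ι-- : ∀ x y → ι (x Z.- y) ≡ ι x Q.- ι y
ι-- x y = trans (ι-+ x (Z.- y)) (cong (ι x Q.+_) (ι-neg y))

ι-injective : ∀ {x y} → ι x ≡ ι y → x ≡ y
ι-injective {x} {y} eq with ℚᵘP.≃-trans (ℚᵘP.≃-sym (ι≃ x)) (ℚᵘP.≃-trans (ℚP.toℚᵘ-cong eq) (ι≃ y))
... | ℚᵘ.*≡* x*1≡y*1 = trans (sym (ℤP.*-identityʳ x)) (trans x*1≡y*1 (ℤP.*-identityʳ y))

ι-^-suc : ∀ x n → ι (x Z.^ suc n) ≡ ι (x Z.^ n) Q.* ι x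
ι-^-suc x n = trans (ι-* x (x Z.^ n)) (ℚP.*-comm (ι x) (ι (x Z.^ n)))

ι-^2 : ∀ x → ι (x Z.^ 2) ≡ ι x Q.* ι x
ι-^2 x = trans (ι-^-suc x 1) (cong (Q._* ι x) (trans (ι-^-suc x 0) (ℚP.*-identityˡ (ι x))))

ι-^3 : ∀ x → ι (x Z.^ 3) ≡ ι x Q.* ι x Q.* ι x
ι-^3 x = trans (ι-^-suc x 2) (cong (Q._* ι x) (ι-^2 x))

ι-^4 : ∀ x → ι (x Z.^ 4) ≡ ι x Q.* ι x Q.* ι x Q.* ι x
ι-^4 x = trans (ι-^-suc x 3) (cong (Q._* ι x) (ι-^3 x))

module _ (h k e : ℤ) where
  open Q using (_+_; _-_; _*_)

  ι-pNumerator : ι (pNumerator h k e) ≡ ι h * ι k - ι e * (ι k * ι k * ι k)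
  ι-pNumerator = trans (ι-- (h Z.* k) (e Z.* k Z.^ 3))
    (cong₂ _-_ (ι-* h k) (trans (ι-* e (k Z.^ 3)) (cong (ι e *_) (ι-^3 k))))

  ι-qNumerator : ι (qNumerator k) ≡ ι k - ι k * ι k * ι k
  ι-qNumerator = trans (ι-- k (k Z.^ 3)) (cong (ι k -_) (ι-^3 k))

  ι-rNumerator : ι (rNumerator h k e) ≡ ι k * ι k - ι e * (1ℚ + 1ℚ) * ι h + 1ℚ
  ι-rNumerator = trans (ι-+ (k Z.^ 2 Z.- e Z.* + 2 Z.* h) (+ 1)) (cong (_+ 1ℚ)
    (trans (ι-- (k Z.^ 2) (e Z.* + 2 Z.* h))
      (cong₂ _-_ (ι-^2 k) (trans (ι-* (e Z.* + 2) h) (cong (_* ι h) (ι-* e (+ 2)))))))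

  ι-sNumerator : ι (sNumerator h k e) ≡ ι h - ι e * (ι k * ι k * ι k * ι k)
  ι-sNumerator = trans (ι-- h (e Z.* k Z.^ 4))
    (cong (ι h -_) (trans (ι-* e (k Z.^ 4)) (cong (ι e *_) (ι-^4 k))))

  ι-tNumerator : ι (tNumerator k) ≡ ι k * ι k * ι k + (1ℚ + 1ℚ) * ι k
  ι-tNumerator = trans (ι-+ (k Z.^ 3) (+ 2 Z.* k)) (cong₂ _+_ (ι-^3 k) (ι-* (+ 2) k))

/-as-ι : ∀ i n .{{_ : NonZero n}} → i Q./ n ≡ ι i Q.* ((+ 1) Q./ n)
/-as-ι i n@(suc n-1) = ℚP.toℚᵘ-injective (ℚᵘP.≃-trans (ℚP.toℚᵘ-fromℚᵘ (ℚᵘ.mkℚᵘ i n-1))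
  (ℚᵘP.≃-sym (ℚᵘP.≃-trans (ℚP.toℚᵘ-homo-* (ι i) ((+ 1) Q./ n))
    (ℚᵘP.≃-trans (ℚᵘP.*-cong (ι≃ i) (ℚP.toℚᵘ-fromℚᵘ (ℚᵘ.mkℚᵘ (+ 1) n-1))) (ℚᵘ.*≡* cross)))))
  where
  cross : (i Z.* + 1) Z.* + n ≡ i Z.* + suc (n-1 N.+ 0)
  cross rewrite ℕP.+-identityʳ n-1 = cong (Z._* + n) (ℤP.*-identityʳ i)

ι-*-inverse : ∀ n .{{_ : NonZero n}} → ι (+ n) Q.* ((+ 1) Q./ n) ≡ 1ℚ
ι-*-inverse n@(suc n-1) = ℚP.toℚᵘ-injective (ℚᵘP.≃-trans (ℚP.toℚᵘ-homo-* (ι (+ n)) ((+ 1) Q./ n))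
  (ℚᵘP.≃-trans (ℚᵘP.*-cong (ι≃ (+ n)) (ℚP.toℚᵘ-fromℚᵘ (ℚᵘ.mkℚᵘ (+ 1) n-1))) (ℚᵘ.*≡* cross)))
  where
  cross : (+ n Z.* + 1) Z.* + 1 ≡ + 1 Z.* + suc (n-1 N.+ 0)
  cross rewrite ℕP.+-identityʳ n-1 = ring (+ n)
    where
    ring : ∀ x → (x Z.* + 1) Z.* + 1 ≡ + 1 Z.* x
    ring = ℤRing.solve-∀

ι-/ℕ-exact : ∀ x d .{{_ : NonZero d}} a → + d ∣ x → ι (+ d) Q.* a ≡ 1ℚ → ι (x /ℕ d) ≡ ι x Q.* a
ι-/ℕ-exact x d a d∣x da≡1 = begin
  ι (x /ℕ d)                  ≡⟨ ℚP.*-identityʳ (ι (x /ℕ d)) ⟨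
  ι (x /ℕ d) * 1ℚ             ≡⟨ cong (ι (x /ℕ d) *_) da≡1 ⟨
  ι (x /ℕ d) * (ι (+ d) * a)  ≡⟨ ℚP.*-assoc (ι (x /ℕ d)) (ι (+ d)) a ⟨
  ι (x /ℕ d) * ι (+ d) * a    ≡⟨ cong (_* a) (ι-* (x /ℕ d) (+ d)) ⟨
  ι (x /ℕ d Z.* + d) * a      ≡⟨ cong (λ y → ι y * a) (ℤP.*-comm (x /ℕ d) (+ d)) ⟩
  ι (+ d Z.* (x /ℕ d)) * a    ≡⟨ cong (λ y → ι y * a) (/ℕ-exact x d d∣x) ⟩
  ι x * a                     ∎
  where
  open ≡-Reasoning
  open Q using (_*_)

-- mulK h k is mulQ (ι (+ mN h k)) by definition.
mulQ : ℚ → K → K → K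
mulQ m ⟨ a₀ , a₁ , a₂ ⟩ ⟨ b₀ , b₁ , b₂ ⟩ =
  ⟨ a₀ Q.* b₀ Q.+ m Q.* (a₁ Q.* b₂ Q.+ a₂ Q.* b₁)
  , a₀ Q.* b₁ Q.+ a₁ Q.* b₀ Q.+ m Q.* (a₂ Q.* b₂)
  , a₀ Q.* b₂ Q.+ a₁ Q.* b₁ Q.+ a₂ Q.* b₀ ⟩

module _ (m : ℚ) where

  mulQ-distribˡ : ∀ x y z → mulQ m x (y +K z) ≡ mulQ m x y +K mulQ m x z
  mulQ-distribˡ ⟨ a₀ , a₁ , a₂ ⟩ ⟨ b₀ , b₁ , b₂ ⟩ ⟨ c₀ , c₁ , c₂ ⟩ =
    cong₃ ⟨_,_,_⟩ (ring₀ m a₀ a₁ a₂ b₀ b₁ b₂ c₀ c₁ c₂) (ring₁ m a₀ a₁ a₂ b₀ b₁ b₂ c₀ c₁ c₂)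
                  (ring₂ a₀ a₁ a₂ b₀ b₁ b₂ c₀ c₁ c₂)
    where
    open Q using (_+_; _*_)
    ring₀ : ∀ m a₀ a₁ a₂ b₀ b₁ b₂ c₀ c₁ c₂ →
      a₀ * (b₀ + c₀) + m * (a₁ * (b₂ + c₂) + a₂ * (b₁ + c₁))
        ≡ (a₀ * b₀ + m * (a₁ * b₂ + a₂ * b₁)) + (a₀ * c₀ + m * (a₁ * c₂ + a₂ * c₁))
    ring₀ = Ring.solve-∀ ℚ-ring
    ring₁ : ∀ m a₀ a₁ a₂ b₀ b₁ b₂ c₀ c₁ c₂ →
      a₀ * (b₁ + c₁) + a₁ * (b₀ + c₀) + m * (a₂ * (b₂ + c₂))
        ≡ (a₀ * b₁ + a₁ * b₀ + m * (a₂ * b₂)) + (a₀ * c₁ + a₁ * c₀ + m * (a₂ * c₂))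
    ring₁ = Ring.solve-∀ ℚ-ring
    ring₂ : ∀ a₀ a₁ a₂ b₀ b₁ b₂ c₀ c₁ c₂ →
      a₀ * (b₂ + c₂) + a₁ * (b₁ + c₁) + a₂ * (b₀ + c₀)
        ≡ (a₀ * b₂ + a₁ * b₁ + a₂ * b₀) + (a₀ * c₂ + a₁ * c₁ + a₂ * c₀)
    ring₂ = Ring.solve-∀ ℚ-ring

  mulQ-·ʳ : ∀ n x y → mulQ m x (n ·K y) ≡ n ·K mulQ m x y
  mulQ-·ʳ n ⟨ a₀ , a₁ , a₂ ⟩ ⟨ b₀ , b₁ , b₂ ⟩ =
    cong₃ ⟨_,_,_⟩ (ring₀ m (ι n) a₀ a₁ a₂ b₀ b₁ b₂) (ring₁ m (ι n) a₀ a₁ a₂ b₀ b₁ b₂)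
                  (ring₂ (ι n) a₀ a₁ a₂ b₀ b₁ b₂)
    where
    open Q using (_+_; _*_)
    ring₀ : ∀ m n a₀ a₁ a₂ b₀ b₁ b₂ →
      a₀ * (n * b₀) + m * (a₁ * (n * b₂) + a₂ * (n * b₁)) ≡ n * (a₀ * b₀ + m * (a₁ * b₂ + a₂ * b₁))
    ring₀ = Ring.solve-∀ ℚ-ring
    ring₁ : ∀ m n a₀ a₁ a₂ b₀ b₁ b₂ →
      a₀ * (n * b₁) + a₁ * (n * b₀) + m * (a₂ * (n * b₂)) ≡ n * (a₀ * b₁ + a₁ * b₀ + m * (a₂ * b₂))
    ring₁ = Ring.solve-∀ ℚ-ring
    ring₂ : ∀ n a₀ a₁ a₂ b₀ b₁ b₂ →
      a₀ * (n * b₂) + a₁ * (n * b₁) + a₂ * (n * b₀) ≡ n * (a₀ * b₂ + a₁ * b₁ + a₂ * b₀)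
    ring₂ = Ring.solve-∀ ℚ-ring

  mulQ-comm : ∀ x y → mulQ m x y ≡ mulQ m y x
  mulQ-comm ⟨ a₀ , a₁ , a₂ ⟩ ⟨ b₀ , b₁ , b₂ ⟩ =
    cong₃ ⟨_,_,_⟩ (ring₀ m a₀ a₁ a₂ b₀ b₁ b₂) (ring₁ m a₀ a₁ a₂ b₀ b₁ b₂) (ring₂ a₀ a₁ a₂ b₀ b₁ b₂)
    where
    open Q using (_+_; _*_)
    ring₀ : ∀ m a₀ a₁ a₂ b₀ b₁ b₂ → a₀ * b₀ + m * (a₁ * b₂ + a₂ * b₁) ≡ b₀ * a₀ + m * (b₁ * a₂ + b₂ * a₁)
    ring₀ = Ring.solve-∀ ℚ-ring
    ring₁ : ∀ m a₀ a₁ a₂ b₀ b₁ b₂ → a₀ * b₁ + a₁ * b₀ + m * (a₂ * b₂) ≡ b₀ * a₁ + b₁ * a₀ + m * (b₂ * a₂)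
    ring₁ = Ring.solve-∀ ℚ-ring
    ring₂ : ∀ a₀ a₁ a₂ b₀ b₁ b₂ → a₀ * b₂ + a₁ * b₁ + a₂ * b₀ ≡ b₀ * a₂ + b₁ * a₁ + b₂ * a₀
    ring₂ = Ring.solve-∀ ℚ-ring

  mulQ-identityˡ : ∀ x → mulQ m 1K x ≡ x
  mulQ-identityˡ ⟨ b₀ , b₁ , b₂ ⟩ = cong₃ ⟨_,_,_⟩ (ring₀ m b₀ b₁ b₂) (ring₁ m b₀ b₁ b₂) (ring₂ b₀ b₁ b₂)
    where
    open Q using (_+_; _*_)
    ring₀ : ∀ m b₀ b₁ b₂ → 1ℚ * b₀ + m * (0ℚ * b₂ + 0ℚ * b₁) ≡ b₀
    ring₀ = Ring.solve-∀ ℚ-ring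
    ring₁ : ∀ m b₀ b₁ b₂ → 1ℚ * b₁ + 0ℚ * b₀ + m * (0ℚ * b₂) ≡ b₁
    ring₁ = Ring.solve-∀ ℚ-ring
    ring₂ : ∀ b₀ b₁ b₂ → 1ℚ * b₂ + 0ℚ * b₁ + 0ℚ * b₀ ≡ b₂
    ring₂ = Ring.solve-∀ ℚ-ring

-- A and B stand for 1/σ and 1/k, so that θ̂ = (k + εkα + α²/k)/σ.
module CubicCoordinates (ĥ k̂ ε̂ σ̂ A B : ℚ) where
  open Q using (_+_; _-_; _*_; -_)

  θ̂ : K
  θ̂ = ⟨ k̂ * A , ε̂ * k̂ * A , A * B ⟩

  inCoordinates : ℚ → ℚ → ℚ → K
  inCoordinates u v w = ⟨ u + w * c0 θ̂ , v + w * c1 θ̂ , w * c2 θ̂ ⟩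

  α̂ : K
  α̂ = ⟨ 0ℚ , 1ℚ , 0ℚ ⟩

  m̂ p̂ q̂ r̂ ŝ t̂ : ℚ
  m̂ = ĥ * k̂ * k̂
  p̂ = (ĥ * k̂ - ε̂ * (k̂ * k̂ * k̂)) * A
  q̂ = (k̂ - k̂ * k̂ * k̂) * A
  r̂ = (k̂ * k̂ - ε̂ * (1ℚ + 1ℚ) * ĥ + 1ℚ) * (A * A)
  ŝ = (ĥ - ε̂ * (k̂ * k̂ * k̂ * k̂)) * (A * A)
  t̂ = (k̂ * k̂ * k̂ + (1ℚ + 1ℚ) * k̂) * A

  inCoordinates-+ : ∀ u v w u′ v′ w′ →
    inCoordinates u v w +K inCoordinates u′ v′ w′ ≡ inCoordinates (u + u′) (v + v′) (w + w′)
  inCoordinates-+ u v w u′ v′ w′ =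
    cong₃ ⟨_,_,_⟩ (ring₀ u w u′ w′ (c0 θ̂)) (ring₀ v w v′ w′ (c1 θ̂)) (ring₁ w w′ (c2 θ̂))
    where
    ring₀ : ∀ u w u′ w′ t → (u + w * t) + (u′ + w′ * t) ≡ (u + u′) + (w + w′) * t
    ring₀ = Ring.solve-∀ ℚ-ring
    ring₁ : ∀ w w′ t → w * t + w′ * t ≡ (w + w′) * t
    ring₁ = Ring.solve-∀ ℚ-ring

  inCoordinates-· : ∀ n u v w → n ·K inCoordinates u v w ≡ inCoordinates (ι n * u) (ι n * v) (ι n * w)
  inCoordinates-· n u v w =
    cong₃ ⟨_,_,_⟩ (ring₀ (ι n) u w (c0 θ̂)) (ring₀ (ι n) v w (c1 θ̂)) (ring₁ (ι n) w (c2 θ̂))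
    where
    ring₀ : ∀ n u w t → n * (u + w * t) ≡ n * u + (n * w) * t
    ring₀ = Ring.solve-∀ ℚ-ring
    ring₁ : ∀ n w t → n * (w * t) ≡ (n * w) * t
    ring₁ = Ring.solve-∀ ℚ-ring

  module _ (σ̂A≡1 : σ̂ * A ≡ 1ℚ) (k̂B≡1 : k̂ * B ≡ 1ℚ) where

    inCoordinates-injective : ∀ u v w u′ v′ w′ → inCoordinates u v w ≡ inCoordinates u′ v′ w′ →
      u ≡ u′ × v ≡ v′ × w ≡ w′
    inCoordinates-injective u v w u′ v′ w′ eq = u≡u′ , v≡v′ , w≡w′
      where
      c2-inverse : ∀ x → (x * c2 θ̂) * (σ̂ * k̂) ≡ x
      c2-inverse x = trans (ring x A B σ̂ k̂) (trans (cong₂ (λ p q → x * (p * q)) σ̂A≡1 k̂B≡1) (ring₁ x))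
        where
        ring : ∀ x a b s k → (x * (a * b)) * (s * k) ≡ x * ((s * a) * (k * b))
        ring = Ring.solve-∀ ℚ-ring
        ring₁ : ∀ x → x * (1ℚ * 1ℚ) ≡ x
        ring₁ = Ring.solve-∀ ℚ-ring
      w≡w′ : w ≡ w′
      w≡w′ = trans (sym (c2-inverse w)) (trans (cong (_* (σ̂ * k̂)) (cong c2 eq)) (c2-inverse w′))
      v≡v′ : v ≡ v′
      v≡v′ = +-cancelʳ (w′ * c1 θ̂) v v′ (trans (cong (λ z → v + z * c1 θ̂) (sym w≡w′)) (cong c1 eq))
      u≡u′ : u ≡ u′
      u≡u′ = +-cancelʳ (w′ * c0 θ̂) u u′ (trans (cong (λ z → u + z * c0 θ̂) (sym w≡w′)) (cong c0 eq))

    module _ (ε̂²≡1 : ε̂ * ε̂ ≡ 1ℚ) where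

      -- Each coordinate of the multiplication table is a polynomial identity once the relations
      -- σ̂A = 1, k̂B = 1 and ε̂² = 1 are added with the displayed multipliers.
      private
        modulo-relations : ∀ {x} y c₁ c₂ c₃ →
          x ≡ y + c₁ * (σ̂ * A - 1ℚ) + c₂ * (k̂ * B - 1ℚ) + c₃ * (ε̂ * ε̂ - 1ℚ) → x ≡ y
        modulo-relations y c₁ c₂ c₃ x≡ rewrite σ̂A≡1 | k̂B≡1 | ε̂²≡1 = trans x≡ (ring y c₁ c₂ c₃)
          where
          ring : ∀ y c₁ c₂ c₃ → y + c₁ * (1ℚ - 1ℚ) + c₂ * (1ℚ - 1ℚ) + c₃ * (1ℚ - 1ℚ) ≡ y
          ring = Ring.solve-∀ ℚ-ring

      α̂α̂ : mulQ m̂ α̂ α̂ ≡ inCoordinates (- (k̂ * k̂)) (- (ε̂ * (k̂ * k̂))) (σ̂ * k̂)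
      α̂α̂ = cong₃ ⟨_,_,_⟩
        (modulo-relations _ (- (k̂ * k̂)) 0ℚ 0ℚ (ring₀ ĥ k̂ ε̂ σ̂ A B))
        (modulo-relations _ (- (ε̂ * (k̂ * k̂))) 0ℚ 0ℚ (ring₁ ĥ k̂ ε̂ σ̂ A B))
        (modulo-relations _ (- (k̂ * B)) (- 1ℚ) 0ℚ (ring₂ ĥ k̂ ε̂ σ̂ A B))
        where
        ring₀ : ∀ h k e s A B → 0ℚ * 0ℚ + h * k * k * (1ℚ * 0ℚ + 0ℚ * 1ℚ)
          ≡ - (k * k) + s * k * (k * A) + - (k * k) * (s * A - 1ℚ) + 0ℚ * (k * B - 1ℚ) + 0ℚ * (e * e - 1ℚ)
        ring₀ = Ring.solve-∀ ℚ-ring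
        ring₁ : ∀ h k e s A B → 0ℚ * 1ℚ + 1ℚ * 0ℚ + h * k * k * (0ℚ * 0ℚ)
          ≡ - (e * (k * k)) + s * k * (e * k * A) + - (e * (k * k)) * (s * A - 1ℚ) + 0ℚ * (k * B - 1ℚ)
            + 0ℚ * (e * e - 1ℚ)
        ring₁ = Ring.solve-∀ ℚ-ring
        ring₂ : ∀ h k e s A B → 0ℚ * 0ℚ + 1ℚ * 1ℚ + 0ℚ * 0ℚ
          ≡ s * k * (A * B) + - (k * B) * (s * A - 1ℚ) + - 1ℚ * (k * B - 1ℚ) + 0ℚ * (e * e - 1ℚ)
        ring₂ = Ring.solve-∀ ℚ-ring

      α̂θ̂ : mulQ m̂ α̂ θ̂ ≡ inCoordinates p̂ q̂ (ε̂ * (k̂ * k̂))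
      α̂θ̂ = cong₃ ⟨_,_,_⟩
        (modulo-relations _ 0ℚ (ĥ * k̂ * A) 0ℚ (ring₀ ĥ k̂ ε̂ σ̂ A B))
        (modulo-relations _ 0ℚ 0ℚ (- (k̂ * k̂ * k̂ * A)) (ring₁ ĥ k̂ ε̂ σ̂ A B))
        (modulo-relations _ 0ℚ (- (ε̂ * k̂ * A)) 0ℚ (ring₂ ĥ k̂ ε̂ σ̂ A B))
        where
        ring₀ : ∀ h k e s A B → 0ℚ * (k * A) + h * k * k * (1ℚ * (A * B) + 0ℚ * (e * k * A))
          ≡ (h * k - e * (k * k * k)) * A + e * (k * k) * (k * A) + 0ℚ * (s * A - 1ℚ)
            + h * k * A * (k * B - 1ℚ) + 0ℚ * (e * e - 1ℚ)
        ring₀ = Ring.solve-∀ ℚ-ring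
        ring₁ : ∀ h k e s A B → 0ℚ * (e * k * A) + 1ℚ * (k * A) + h * k * k * (0ℚ * (A * B))
          ≡ (k - k * k * k) * A + e * (k * k) * (e * k * A) + 0ℚ * (s * A - 1ℚ) + 0ℚ * (k * B - 1ℚ)
            + - (k * k * k * A) * (e * e - 1ℚ)
        ring₁ = Ring.solve-∀ ℚ-ring
        ring₂ : ∀ h k e s A B → 0ℚ * (A * B) + 1ℚ * (e * k * A) + 0ℚ * (k * A)
          ≡ e * (k * k) * (A * B) + 0ℚ * (s * A - 1ℚ) + - (e * k * A) * (k * B - 1ℚ) + 0ℚ * (e * e - 1ℚ)
        ring₂ = Ring.solve-∀ ℚ-ring

      θ̂θ̂ : mulQ m̂ θ̂ θ̂ ≡ inCoordinates (- (k̂ * k̂ * r̂)) ŝ t̂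
      θ̂θ̂ = cong₃ ⟨_,_,_⟩
        (modulo-relations _ 0ℚ ((1ℚ + 1ℚ) * ε̂ * ĥ * k̂ * k̂ * A * A) 0ℚ (ring₀ ĥ k̂ ε̂ σ̂ A B))
        (modulo-relations _ 0ℚ (ĥ * A * A * (k̂ * B + 1ℚ)) 0ℚ (ring₁ ĥ k̂ ε̂ σ̂ A B))
        (modulo-relations _ 0ℚ (- (k̂ * k̂ * A * A)) (k̂ * k̂ * A * A) (ring₂ ĥ k̂ ε̂ σ̂ A B))
        where
        ring₀ : ∀ h k e s A B → k * A * (k * A) + h * k * k * (e * k * A * (A * B) + A * B * (e * k * A))
          ≡ - (k * k * ((k * k - e * (1ℚ + 1ℚ) * h + 1ℚ) * (A * A)))
            + (k * k * k + (1ℚ + 1ℚ) * k) * A * (k * A) + 0ℚ * (s * A - 1ℚ)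
            + (1ℚ + 1ℚ) * e * h * k * k * A * A * (k * B - 1ℚ) + 0ℚ * (e * e - 1ℚ)
        ring₀ = Ring.solve-∀ ℚ-ring
        ring₁ : ∀ h k e s A B → k * A * (e * k * A) + e * k * A * (k * A) + h * k * k * (A * B * (A * B))
          ≡ (h - e * (k * k * k * k)) * (A * A) + (k * k * k + (1ℚ + 1ℚ) * k) * A * (e * k * A)
            + 0ℚ * (s * A - 1ℚ) + h * A * A * (k * B + 1ℚ) * (k * B - 1ℚ) + 0ℚ * (e * e - 1ℚ)
        ring₁ = Ring.solve-∀ ℚ-ring
        ring₂ : ∀ h k e s A B → k * A * (A * B) + e * k * A * (e * k * A) + A * B * (k * A)
          ≡ (k * k * k + (1ℚ + 1ℚ) * k) * A * (A * B) + 0ℚ * (s * A - 1ℚ)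
            + - (k * k * A * A) * (k * B - 1ℚ) + k * k * A * A * (e * e - 1ℚ)
        ring₂ = Ring.solve-∀ ℚ-ring

ℤ³ : Set
ℤ³ = ℤ × ℤ × ℤ

infixl 6 _⊕_
infixr 7 _⊙_
infixr 8 _⊛_

_⊕_ : ℤ³ → ℤ³ → ℤ³
(u₀ , u₁ , u₂) ⊕ (v₀ , v₁ , v₂) = (u₀ Z.+ v₀ , u₁ Z.+ v₁ , u₂ Z.+ v₂)

_⊙_ : ℤ → ℤ³ → ℤ³
n ⊙ (u₀ , u₁ , u₂) = (n Z.* u₀ , n Z.* u₁ , n Z.* u₂)

Mat : Set
Mat = ℤ³ × ℤ³ × ℤ³

_⊛_ : Mat → ℤ³ → ℤ³
(c₀ , c₁ , c₂) ⊛ (x₀ , x₁ , x₂) = (x₀ ⊙ c₀ ⊕ x₁ ⊙ c₁) ⊕ x₂ ⊙ c₂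

_⊚_ : Mat → Mat → Mat
M ⊚ (d₀ , d₁ , d₂) = M ⊛ d₀ , M ⊛ d₁ , M ⊛ d₂

⊛-⊚ : ∀ M N x → M ⊛ (N ⊛ x) ≡ (M ⊚ N) ⊛ x
⊛-⊚ ((a₀ , a₁ , a₂) , (b₀ , b₁ , b₂) , (c₀ , c₁ , c₂))
    ((d₀₀ , d₀₁ , d₀₂) , (d₁₀ , d₁₁ , d₁₂) , (d₂₀ , d₂₁ , d₂₂)) (x₀ , x₁ , x₂) =
  cong₃ (λ x y z → x , y , z) (row a₀ b₀ c₀) (row a₁ b₁ c₁) (row a₂ b₂ c₂)
  where
  open Z using (_+_; _*_)
  row : ∀ a b c →
    (x₀ * d₀₀ + x₁ * d₁₀ + x₂ * d₂₀) * a + (x₀ * d₀₁ + x₁ * d₁₁ + x₂ * d₂₁) * b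
      + (x₀ * d₀₂ + x₁ * d₁₂ + x₂ * d₂₂) * c
    ≡ x₀ * (d₀₀ * a + d₀₁ * b + d₀₂ * c) + x₁ * (d₁₀ * a + d₁₁ * b + d₁₂ * c)
      + x₂ * (d₂₀ * a + d₂₁ * b + d₂₂ * c)
  row a b c = ring a b c d₀₀ d₀₁ d₀₂ d₁₀ d₁₁ d₁₂ d₂₀ d₂₁ d₂₂ x₀ x₁ x₂
    where
    ring : ∀ a b c d₀₀ d₀₁ d₀₂ d₁₀ d₁₁ d₁₂ d₂₀ d₂₁ d₂₂ x₀ x₁ x₂ →
      (x₀ * d₀₀ + x₁ * d₁₀ + x₂ * d₂₀) * a + (x₀ * d₀₁ + x₁ * d₁₁ + x₂ * d₂₁) * b
        + (x₀ * d₀₂ + x₁ * d₁₂ + x₂ * d₂₂) * c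
      ≡ x₀ * (d₀₀ * a + d₀₁ * b + d₀₂ * c) + x₁ * (d₁₀ * a + d₁₁ * b + d₁₂ * c)
        + x₂ * (d₂₀ * a + d₂₁ * b + d₂₂ * c)
    ring = ℤRing.solve-∀

⊛-⊕ : ∀ M x y → M ⊛ x ⊕ M ⊛ y ≡ M ⊛ (x ⊕ y)
⊛-⊕ ((a₀ , a₁ , a₂) , (b₀ , b₁ , b₂) , (c₀ , c₁ , c₂)) (x₀ , x₁ , x₂) (y₀ , y₁ , y₂) =
  cong₃ (λ x y z → x , y , z) (ring a₀ b₀ c₀ x₀ x₁ x₂ y₀ y₁ y₂) (ring a₁ b₁ c₁ x₀ x₁ x₂ y₀ y₁ y₂)
    (ring a₂ b₂ c₂ x₀ x₁ x₂ y₀ y₁ y₂)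
  where
  open Z using (_+_; _*_)
  ring : ∀ a b c x₀ x₁ x₂ y₀ y₁ y₂ →
    (x₀ * a + x₁ * b + x₂ * c) + (y₀ * a + y₁ * b + y₂ * c) ≡ (x₀ + y₀) * a + (x₁ + y₁) * b + (x₂ + y₂) * c
  ring = ℤRing.solve-∀

infix 4 _∈⟨_⟩ _⊑_

_∈⟨_⟩ : ℤ³ → Mat → Set
x ∈⟨ G ⟩ = ∃ λ X → x ≡ G ⊛ X

_⊑_ : Mat → Mat → Set
(c₀ , c₁ , c₂) ⊑ G = c₀ ∈⟨ G ⟩ × c₁ ∈⟨ G ⟩ × c₂ ∈⟨ G ⟩

0∈⟨⟩ : ∀ G → (+ 0 , + 0 , + 0) ∈⟨ G ⟩
0∈⟨⟩ ((a₀ , a₁ , a₂) , (b₀ , b₁ , b₂) , (c₀ , c₁ , c₂)) =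
  (+ 0 , + 0 , + 0) , cong₃ (λ x y z → x , y , z) (ring a₀ b₀ c₀) (ring a₁ b₁ c₁) (ring a₂ b₂ c₂)
  where
  open Z using (_+_; _*_)
  ring : ∀ a b c → + 0 ≡ + 0 * a + + 0 * b + + 0 * c
  ring = ℤRing.solve-∀

⊕-∈⟨⟩ : ∀ {G x y} → x ∈⟨ G ⟩ → y ∈⟨ G ⟩ → x ⊕ y ∈⟨ G ⟩
⊕-∈⟨⟩ {G} (X , refl) (Y , refl) = X ⊕ Y , ⊛-⊕ G X Y

⊛-∈⟨⟩ : ∀ {N G} → N ⊑ G → ∀ x → N ⊛ x ∈⟨ G ⟩
⊛-∈⟨⟩ {G = G} ((X₀ , refl) , (X₁ , refl) , (X₂ , refl)) x =
  (X₀ , X₁ , X₂) ⊛ x , sym (⊛-⊚ G (X₀ , X₁ , X₂) x)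

⊛-preserves-∈⟨⟩ : ∀ {N G y} → N ⊚ G ⊑ G → y ∈⟨ G ⟩ → N ⊛ y ∈⟨ G ⟩
⊛-preserves-∈⟨⟩ {N} {G} N⊚G⊑G (Y , refl) = subst (_∈⟨ G ⟩) (sym (⊛-⊚ N G Y)) (⊛-∈⟨⟩ N⊚G⊑G Y)

⊑-refl : ∀ G → G ⊑ G
⊑-refl ((a₀ , a₁ , a₂) , (b₀ , b₁ , b₂) , (c₀ , c₁ , c₂)) =
  ((+ 1 , + 0 , + 0) , cong₃ (λ x y z → x , y , z) (ring₀ a₀ b₀ c₀) (ring₀ a₁ b₁ c₁) (ring₀ a₂ b₂ c₂)) ,
  ((+ 0 , + 1 , + 0) , cong₃ (λ x y z → x , y , z) (ring₁ a₀ b₀ c₀) (ring₁ a₁ b₁ c₁) (ring₁ a₂ b₂ c₂)) ,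
  ((+ 0 , + 0 , + 1) , cong₃ (λ x y z → x , y , z) (ring₂ a₀ b₀ c₀) (ring₂ a₁ b₁ c₁) (ring₂ a₂ b₂ c₂))
  where
  open Z using (_+_; _*_)
  ring₀ : ∀ a b c → a ≡ + 1 * a + + 0 * b + + 0 * c
  ring₀ = ℤRing.solve-∀
  ring₁ : ∀ a b c → b ≡ + 0 * a + + 1 * b + + 0 * c
  ring₁ = ℤRing.solve-∀
  ring₂ : ∀ a b c → c ≡ + 0 * a + + 0 * b + + 1 * c
  ring₂ = ℤRing.solve-∀

hnf : ℤ → ℤ → ℤ → ℤ → ℤ → ℤ → Mat
hnf a b c d e f = (a , + 0 , + 0) , (b , c , + 0) , (d , e , f)

module _ (a b c d e f : ℤ) .{{_ : Z.NonZero c}} .{{_ : Z.NonZero f}} where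
  open Z using (_+_; _-_; _*_)

  HNFDivisibility : ℤ³ → Set
  HNFDivisibility (U , V , W) =
    f ∣ W × c * f ∣ V * f - W * e × a * c * f ∣ U * c * f - (V * f - W * e) * b - W * c * d

  ∈hnf⇒divisibility : ∀ {x} → x ∈⟨ hnf a b c d e f ⟩ → HNFDivisibility x
  ∈hnf⇒divisibility ((X , Y , Z) , refl) =
    divides Z (ring₀ X Y Z f) , divides Y (ring₁ X Y Z c e f) , divides X (ring₂ X Y Z a b c d e f)
    where
    ring₀ : ∀ X Y Z f → X * + 0 + Y * + 0 + Z * f ≡ Z * f
    ring₀ = ℤRing.solve-∀
    ring₁ : ∀ X Y Z c e f → (X * + 0 + Y * c + Z * e) * f - (X * + 0 + Y * + 0 + Z * f) * e ≡ Y * (c * f)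
    ring₁ = ℤRing.solve-∀
    ring₂ : ∀ X Y Z a b c d e f →
      (X * a + Y * b + Z * d) * c * f - ((X * + 0 + Y * c + Z * e) * f - (X * + 0 + Y * + 0 + Z * f) * e) * b
        - (X * + 0 + Y * + 0 + Z * f) * c * d ≡ X * (a * c * f)
    ring₂ = ℤRing.solve-∀

  divisibility⇒∈hnf : ∀ {x} → HNFDivisibility x → x ∈⟨ hnf a b c d e f ⟩
  divisibility⇒∈hnf {U , V , W} (divides Z W≡Zf , divides Y V′≡Ycf , divides X U′≡Xacf) =
    (X , Y , Z) , cong₃ (λ x y z → x , y , z) U≡ V≡ W≡
    where
    instance
      cf≢0 : Z.NonZero (c * f)
      cf≢0 = ℤP.i*j≢0 c f
    W≡ : W ≡ X * + 0 + Y * + 0 + Z * f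
    W≡ = trans W≡Zf (ring X Y Z f)
      where
      ring : ∀ X Y Z f → Z * f ≡ X * + 0 + Y * + 0 + Z * f
      ring = ℤRing.solve-∀
    V≡ : V ≡ X * + 0 + Y * c + Z * e
    V≡ = ℤP.*-cancelʳ-≡ V (X * + 0 + Y * c + Z * e) f (begin
      V * f                           ≡⟨ ring₀ V W e f ⟩
      (V * f - W * e) + W * e         ≡⟨ cong₂ (λ v w → v + w * e) V′≡Ycf W≡Zf ⟩
      Y * (c * f) + Z * f * e         ≡⟨ ring₁ X Y Z c e f ⟩
      (X * + 0 + Y * c + Z * e) * f   ∎)
      where
      open ≡-Reasoning
      ring₀ : ∀ V W e f → V * f ≡ (V * f - W * e) + W * e
      ring₀ = ℤRing.solve-∀
      ring₁ : ∀ X Y Z c e f → Y * (c * f) + Z * f * e ≡ (X * + 0 + Y * c + Z * e) * f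
      ring₁ = ℤRing.solve-∀
    U≡ : U ≡ X * a + Y * b + Z * d
    U≡ = ℤP.*-cancelʳ-≡ U (X * a + Y * b + Z * d) (c * f) (begin
      U * (c * f)
        ≡⟨ ring₀ U V W b c d e f ⟩
      (U * c * f - (V * f - W * e) * b - W * c * d) + (V * f - W * e) * b + W * c * d
        ≡⟨ cong₃ (λ u v w → u + v * b + w * c * d) U′≡Xacf V′≡Ycf W≡Zf ⟩
      X * (a * c * f) + Y * (c * f) * b + Z * f * c * d
        ≡⟨ ring₁ X Y Z a b c d f ⟩
      (X * a + Y * b + Z * d) * (c * f) ∎)
      where
      open ≡-Reasoning
      ring₀ : ∀ U V W b c d e f →
        U * (c * f) ≡ (U * c * f - (V * f - W * e) * b - W * c * d) + (V * f - W * e) * b + W * c * d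
      ring₀ = ℤRing.solve-∀
      ring₁ : ∀ X Y Z a b c d f →
        X * (a * c * f) + Y * (c * f) * b + Z * f * c * d ≡ (X * a + Y * b + Z * d) * (c * f)
      ring₁ = ℤRing.solve-∀

∣-≡ : ∀ {d x y} → x ≡ y → d ∣ x → d ∣ y
∣-≡ {d} = subst (d ∣_)

≡-∣ : ∀ {d d′ x} → d ≡ d′ → d ∣ x → d′ ∣ x
≡-∣ {x = x} = subst (_∣ x)

∣-neg⇒∣ : ∀ {d} x → d ∣ Z.- x → d ∣ x
∣-neg⇒∣ x d∣-x = ∣-≡ (ℤP.neg-involutive x) (ℤS.∣m⇒∣-m d∣-x)

∣-+multiple⇔ : ∀ {d} x y z → d ∣ z → d ∣ x Z.+ y Z.* z ⇔ d ∣ x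
∣-+multiple⇔ x y z d∣z = mk⇔ (λ d∣sum → ℤS.∣m+n∣n⇒∣m d∣sum (ℤS.∣n⇒∣m*n y d∣z))
                            (λ d∣x → ℤS.∣m∣n⇒∣m+n d∣x (ℤS.∣n⇒∣m*n y d∣z))

module StructureMatrices (σ ε K p q r s t : ℤ) where
  open Z using (_+_; _-_; _*_; _^_; -_)

  α²-coords αθ-coords θ²-coords : ℤ³
  α²-coords = - (K * K) , - (ε * (K * K)) , σ * K
  αθ-coords = p , q , ε * (K * K)
  θ²-coords = - (K * K * r) , s , t

  mulα mulθ : Mat
  mulα = (+ 0 , + 1 , + 0) , α²-coords , αθ-coords
  mulθ = (+ 0 , + 0 , + 1) , αθ-coords , θ²-coords

  module _ (a b c d e f : ℤ) .{{_ : Z.NonZero a}} .{{_ : Z.NonZero c}} .{{_ : Z.NonZero f}} where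
    private
      G : Mat
      G = hnf a b c d e f
      D : ℤ³ → Set
      D = HNFDivisibility a b c d e f
      f∣f : f ∣ f
      f∣f = ℤS.∣-refl
      instance
        af≢0 : Z.NonZero (a * f)
        af≢0 = ℤP.i*j≢0 a f

    -- tNx is the quantity whose divisibility is condition (Nx).
    X t2b t2c t2d t2e t3c t3d t3e t4a t4b t4c t4d : ℤ
    X = b * e - c * d
    t2b = σ * K * c
    t2c = σ * K * e
    t2d = b + ε * K ^ 2 * c
    t2e = d + ε * K ^ 2 * e
    t3c = b * e + ε * K ^ 2 * c * e
    t3d = d * f + q * f ^ 2 - σ * K * e ^ 2 - ε * (+ 2) * K ^ 2 * e * f
    t3e = q * e * f + s * f ^ 2 - d * e - t * e * f - ε * K ^ 2 * e ^ 2
    t4a = (K ^ 2 * c ^ 2 + b ^ 2) * f - ε * K ^ 2 * b * c * f - σ * K * c * X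
    t4b = (p * c - q * b) * c * f + (b + ε * K ^ 2 * c) * X
    t4c = (p * c * f - K ^ 2 * c * e - b * d - q * b * f) * f + ε * K ^ 2 * f * ((+ 2) * b * e - c * d)
          + σ * K * e * X
    t4d = (p * c * e - r * K ^ 2 * c * f - q * b * e - s * b * f) * f + (d + t * f + ε * K ^ 2 * e) * X

    α·g₁⇔ : D (mulα ⊛ (a , + 0 , + 0)) ⇔ (c ∣ a × c ∣ b)
    α·g₁⇔ = mk⇔
      (λ (_ , cf∣ , acf∣) →
        ℤS.*-cancelʳ-∣ f {c} {a} (∣-≡ (ring₂ a e f σ ε K q) cf∣) ,
        ℤS.*-cancelˡ-∣ (a * f) {c} {b}
          (∣-neg⇒∣ (a * f * b) (≡-∣ (acf≡afc a c f) (∣-≡ (ring₃ a b c d e f σ ε K p q) acf∣))))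
      (λ (c∣a , c∣b) →
        divides (+ 0) (ring₁ a f σ ε K) ,
        ∣-≡ (sym (ring₂ a e f σ ε K q)) (ℤS.*-monoˡ-∣ f c∣a) ,
        ∣-≡ (sym (ring₃ a b c d e f σ ε K p q))
          (≡-∣ (sym (acf≡afc a c f)) (ℤS.∣m⇒∣-m (ℤS.*-monoʳ-∣ (a * f) c∣b))))
      where
      acf≡afc : ∀ a c f → a * c * f ≡ a * f * c
      acf≡afc = ℤRing.solve-∀
      ring₁ : ∀ a f σ ε K →
        a * + 0 + + 0 * (σ * K) + + 0 * (ε * (K * K))
        ≡ + 0 * f
      ring₁ = ℤRing.solve-∀
      ring₂ : ∀ a e f σ ε K q →
        (a * + 1 + + 0 * - (ε * (K * K)) + + 0 * q) * f
          - (a * + 0 + + 0 * (σ * K) + + 0 * (ε * (K * K))) * e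
        ≡ a * f
      ring₂ = ℤRing.solve-∀
      ring₃ : ∀ a b c d e f σ ε K p q →
        (a * + 0 + + 0 * - (K * K) + + 0 * p) * c * f
          - ((a * + 1 + + 0 * - (ε * (K * K)) + + 0 * q) * f - (a * + 0 + + 0 * (σ * K) + + 0 * (ε * (K * K))) * e) * b
          - (a * + 0 + + 0 * (σ * K) + + 0 * (ε * (K * K))) * c * d
        ≡ - (a * f * b)
      ring₃ = ℤRing.solve-∀

    α·g₂⇔ : c ∣ b → f ∣ t2c → D (mulα ⊛ (b , c , + 0)) ⇔ (f ∣ t2b × a * c * f ∣ t4a)
    α·g₂⇔ c∣b f∣t2c = mk⇔
      (λ (f∣ , _ , acf∣) → ∣-≡ (ring₁ b c σ ε K) f∣ , ∣-neg⇒∣ t4a (∣-≡ (ring₃ b c d e f σ ε K p q) acf∣))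
      (λ (f∣ , acf∣) →
        ∣-≡ (sym (ring₁ b c σ ε K)) f∣ ,
        ∣-≡ (sym (ring₂ b c e f σ ε K q))
          (ℤS.∣m∣n⇒∣m-n (ℤS.*-monoˡ-∣ f (ℤS.∣m∣n⇒∣m-n c∣b (ℤS.∣n⇒∣m*n (ε * K ^ 2) ℤS.∣-refl)))
                        (ℤS.*-monoʳ-∣ c f∣t2c)) ,
        ∣-≡ (sym (ring₃ b c d e f σ ε K p q)) (ℤS.∣m⇒∣-m acf∣))
      where
      ring₁ : ∀ b c σ ε K →
        b * + 0 + c * (σ * K) + + 0 * (ε * (K * K))
        ≡ σ * K * c
      ring₁ = ℤRing.solve-∀
      ring₂ : ∀ b c e f σ ε K q →
        (b * + 1 + c * - (ε * (K * K)) + + 0 * q) * f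
          - (b * + 0 + c * (σ * K) + + 0 * (ε * (K * K))) * e
        ≡ (b - ε * (K * (K * + 1)) * c) * f - c * (σ * K * e)
      ring₂ = ℤRing.solve-∀
      ring₃ : ∀ b c d e f σ ε K p q →
        (b * + 0 + c * - (K * K) + + 0 * p) * c * f
          - ((b * + 1 + c * - (ε * (K * K)) + + 0 * q) * f - (b * + 0 + c * (σ * K) + + 0 * (ε * (K * K))) * e) * b
          - (b * + 0 + c * (σ * K) + + 0 * (ε * (K * K))) * c * d
        ≡ - (((K * (K * + 1)) * (c * (c * + 1)) + b * (b * + 1)) * f - ε * (K * (K * + 1)) * b * c * f
             - σ * K * c * (b * e - c * d))
      ring₃ = ℤRing.solve-∀

    α·g₃⇔ : D (mulα ⊛ (d , e , f)) ⇔ (f ∣ t2c × c * f ∣ t3d × a * c * f ∣ t4c)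
    α·g₃⇔ = mk⇔
      (λ (f∣ , cf∣ , acf∣) →
        Equivalence.to (∣-+multiple⇔ t2c (ε * (K * K)) f f∣f) (∣-≡ (ring₁ d e f σ ε K) f∣) ,
        ∣-≡ (ring₂ d e f σ ε K q) cf∣ , ∣-≡ (ring₃ b c d e f σ ε K p q) acf∣)
      (λ (f∣ , cf∣ , acf∣) →
        ∣-≡ (sym (ring₁ d e f σ ε K)) (Equivalence.from (∣-+multiple⇔ t2c (ε * (K * K)) f f∣f) f∣) ,
        ∣-≡ (sym (ring₂ d e f σ ε K q)) cf∣ ,
        ∣-≡ (sym (ring₃ b c d e f σ ε K p q)) acf∣)
      where
      ring₁ : ∀ d e f σ ε K →
        d * + 0 + e * (σ * K) + f * (ε * (K * K))
        ≡ σ * K * e + ε * (K * K) * f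
      ring₁ = ℤRing.solve-∀
      ring₂ : ∀ d e f σ ε K q →
        (d * + 1 + e * - (ε * (K * K)) + f * q) * f
          - (d * + 0 + e * (σ * K) + f * (ε * (K * K))) * e
        ≡ d * f + q * (f * (f * + 1)) - σ * K * (e * (e * + 1)) - ε * (+ 2) * (K * (K * + 1)) * e * f
      ring₂ = ℤRing.solve-∀
      ring₃ : ∀ b c d e f σ ε K p q →
        (d * + 0 + e * - (K * K) + f * p) * c * f
          - ((d * + 1 + e * - (ε * (K * K)) + f * q) * f - (d * + 0 + e * (σ * K) + f * (ε * (K * K))) * e) * b
          - (d * + 0 + e * (σ * K) + f * (ε * (K * K))) * c * d
        ≡ (p * c * f - (K * (K * + 1)) * c * e - b * d - q * b * f) * f
          + ε * (K * (K * + 1)) * f * ((+ 2) * b * e - c * d) + σ * K * e * (b * e - c * d)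
      ring₃ = ℤRing.solve-∀

    θ·g₁⇔ : D (mulθ ⊛ (a , + 0 , + 0)) ⇔ (f ∣ a × c * f ∣ a * e × c * f ∣ X)
    θ·g₁⇔ = mk⇔
      (λ (f∣ , cf∣ , acf∣) →
        ∣-≡ (ring₁ a ε K t) f∣ ,
        ∣-neg⇒∣ (a * e) (∣-≡ (ring₂ a e f ε K q s t) cf∣) ,
        ℤS.*-cancelˡ-∣ a {c * f} {X}
          (≡-∣ (ℤP.*-assoc a c f) (∣-≡ (ring₃ a b c d e f ε K p q r s t) acf∣)))
      (λ (f∣a , cf∣ae , cf∣X) →
        ∣-≡ (sym (ring₁ a ε K t)) f∣a ,
        ∣-≡ (sym (ring₂ a e f ε K q s t)) (ℤS.∣m⇒∣-m cf∣ae) ,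
        ∣-≡ (sym (ring₃ a b c d e f ε K p q r s t)) (≡-∣ (sym (ℤP.*-assoc a c f)) (ℤS.*-monoʳ-∣ a cf∣X)))
      where
      ring₁ : ∀ a ε K t →
        a * + 1 + + 0 * (ε * (K * K)) + + 0 * t
        ≡ a
      ring₁ = ℤRing.solve-∀
      ring₂ : ∀ a e f ε K q s t →
        (a * + 0 + + 0 * q + + 0 * s) * f
          - (a * + 1 + + 0 * (ε * (K * K)) + + 0 * t) * e
        ≡ - (a * e)
      ring₂ = ℤRing.solve-∀
      ring₃ : ∀ a b c d e f ε K p q r s t →
        (a * + 0 + + 0 * p + + 0 * - (K * K * r)) * c * f
          - ((a * + 0 + + 0 * q + + 0 * s) * f - (a * + 1 + + 0 * (ε * (K * K)) + + 0 * t) * e) * b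
          - (a * + 1 + + 0 * (ε * (K * K)) + + 0 * t) * c * d
        ≡ a * (b * e - c * d)
      ring₃ = ℤRing.solve-∀

    θ·g₂⇔ : D (mulθ ⊛ (b , c , + 0)) ⇔ (f ∣ t2d × c * f ∣ t3c × a * c * f ∣ t4b)
    θ·g₂⇔ = mk⇔
      (λ (f∣ , cf∣ , acf∣) →
        ∣-≡ (ring₁ b c ε K t) f∣ ,
        ∣-≡ (x-[x-y]≡y (c * f * q) t3c) (ℤS.∣m∣n⇒∣m-n cf∣cfq (∣-≡ (ring₂ b c e f ε K q s t) cf∣)) ,
        ∣-≡ (ring₃ b c d e f ε K p q r s t) acf∣)
      (λ (f∣ , cf∣ , acf∣) →
        ∣-≡ (sym (ring₁ b c ε K t)) f∣ ,
        ∣-≡ (sym (ring₂ b c e f ε K q s t)) (ℤS.∣m∣n⇒∣m-n cf∣cfq cf∣) ,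
        ∣-≡ (sym (ring₃ b c d e f ε K p q r s t)) acf∣)
      where
      cf∣cfq : c * f ∣ c * f * q
      cf∣cfq = ℤS.∣m⇒∣m*n q ℤS.∣-refl
      x-[x-y]≡y : ∀ x y → x - (x - y) ≡ y
      x-[x-y]≡y = ℤRing.solve-∀
      ring₁ : ∀ b c ε K t →
        b * + 1 + c * (ε * (K * K)) + + 0 * t
        ≡ b + ε * (K * (K * + 1)) * c
      ring₁ = ℤRing.solve-∀
      ring₂ : ∀ b c e f ε K q s t →
        (b * + 0 + c * q + + 0 * s) * f
          - (b * + 1 + c * (ε * (K * K)) + + 0 * t) * e
        ≡ c * f * q - (b * e + ε * (K * (K * + 1)) * c * e)
      ring₂ = ℤRing.solve-∀
      ring₃ : ∀ b c d e f ε K p q r s t →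
        (b * + 0 + c * p + + 0 * - (K * K * r)) * c * f
          - ((b * + 0 + c * q + + 0 * s) * f - (b * + 1 + c * (ε * (K * K)) + + 0 * t) * e) * b
          - (b * + 1 + c * (ε * (K * K)) + + 0 * t) * c * d
        ≡ (p * c - q * b) * c * f + (b + ε * (K * (K * + 1)) * c) * (b * e - c * d)
      ring₃ = ℤRing.solve-∀

    θ·g₃⇔ : D (mulθ ⊛ (d , e , f)) ⇔ (f ∣ t2e × c * f ∣ t3e × a * c * f ∣ t4d)
    θ·g₃⇔ = mk⇔
      (λ (f∣ , cf∣ , acf∣) →
        Equivalence.to (∣-+multiple⇔ t2e t f f∣f) (∣-≡ (ring₁ d e f ε K t) f∣) ,
        ∣-≡ (ring₂ d e f ε K q s t) cf∣ , ∣-≡ (ring₃ b c d e f ε K p q r s t) acf∣)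
      (λ (f∣ , cf∣ , acf∣) →
        ∣-≡ (sym (ring₁ d e f ε K t)) (Equivalence.from (∣-+multiple⇔ t2e t f f∣f) f∣) ,
        ∣-≡ (sym (ring₂ d e f ε K q s t)) cf∣ ,
        ∣-≡ (sym (ring₃ b c d e f ε K p q r s t)) acf∣)
      where
      ring₁ : ∀ d e f ε K t →
        d * + 1 + e * (ε * (K * K)) + f * t
        ≡ d + ε * (K * (K * + 1)) * e + t * f
      ring₁ = ℤRing.solve-∀
      ring₂ : ∀ d e f ε K q s t →
        (d * + 0 + e * q + f * s) * f
          - (d * + 1 + e * (ε * (K * K)) + f * t) * e
        ≡ q * e * f + s * (f * (f * + 1)) - d * e - t * e * f - ε * (K * (K * + 1)) * (e * (e * + 1))
      ring₂ = ℤRing.solve-∀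
      ring₃ : ∀ b c d e f ε K p q r s t →
        (d * + 0 + e * p + f * - (K * K * r)) * c * f
          - ((d * + 0 + e * q + f * s) * f - (d * + 1 + e * (ε * (K * K)) + f * t) * e) * b
          - (d * + 1 + e * (ε * (K * K)) + f * t) * c * d
        ≡ (p * c * e - r * (K * (K * + 1)) * c * f - q * b * e - s * b * f) * f
          + (d + t * f + ε * (K * (K * + 1)) * e) * (b * e - c * d)
      ring₃ = ℤRing.solve-∀

    Conditions′ : Set
    Conditions′ =
      c ∣ᵤ a × c ∣ᵤ b ×
      f ∣ᵤ a × f ∣ᵤ t2b × f ∣ᵤ t2c × f ∣ᵤ t2d × f ∣ᵤ t2e ×
      c * f ∣ᵤ a * e × c * f ∣ᵤ X × c * f ∣ᵤ t3c × c * f ∣ᵤ t3d × c * f ∣ᵤ t3e ×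
      a * c * f ∣ᵤ t4a × a * c * f ∣ᵤ t4b × a * c * f ∣ᵤ t4c × a * c * f ∣ᵤ t4d

    closure⇒conditions : mulα ⊚ G ⊑ G × mulθ ⊚ G ⊑ G → Conditions′
    closure⇒conditions ((α₁∈ , α₂∈ , α₃∈) , (θ₁∈ , θ₂∈ , θ₃∈)) = conditions
      (Equivalence.to α·g₁⇔ (∈⇒D α₁∈)) (Equivalence.to α·g₃⇔ (∈⇒D α₃∈))
      (Equivalence.to θ·g₁⇔ (∈⇒D θ₁∈)) (Equivalence.to θ·g₂⇔ (∈⇒D θ₂∈))
      (Equivalence.to θ·g₃⇔ (∈⇒D θ₃∈))
      where
      ∈⇒D : ∀ {x} → x ∈⟨ G ⟩ → D x
      ∈⇒D {x} = ∈hnf⇒divisibility a b c d e f {x}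
      conditions : c ∣ a × c ∣ b → f ∣ t2c × c * f ∣ t3d × a * c * f ∣ t4c →
        f ∣ a × c * f ∣ a * e × c * f ∣ X → f ∣ t2d × c * f ∣ t3c × a * c * f ∣ t4b →
        f ∣ t2e × c * f ∣ t3e × a * c * f ∣ t4d → Conditions′
      conditions (1a , 1b) (2c , 3d , 4c) (2a , 3a , 3b) (2d , 3c , 4b) (2e , 3e , 4d) =
        ∣⇒∣ᵤ 1a , ∣⇒∣ᵤ 1b , ∣⇒∣ᵤ 2a , ∣⇒∣ᵤ (proj₁ α₂) , ∣⇒∣ᵤ 2c , ∣⇒∣ᵤ 2d , ∣⇒∣ᵤ 2e ,
        ∣⇒∣ᵤ 3a , ∣⇒∣ᵤ 3b , ∣⇒∣ᵤ 3c , ∣⇒∣ᵤ 3d , ∣⇒∣ᵤ 3e ,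
        ∣⇒∣ᵤ (proj₂ α₂) , ∣⇒∣ᵤ 4b , ∣⇒∣ᵤ 4c , ∣⇒∣ᵤ 4d
        where
        α₂ : f ∣ t2b × a * c * f ∣ t4a
        α₂ = Equivalence.to (α·g₂⇔ 1b 2c) (∈⇒D α₂∈)

    conditions⇒closure : Conditions′ → mulα ⊚ G ⊑ G × mulθ ⊚ G ⊑ G
    conditions⇒closure (1a , 1b , 2a , 2b , 2c , 2d , 2e , 3a , 3b , 3c , 3d , 3e , 4a , 4b , 4c , 4d) =
      ( D⇒∈ (Equivalence.from α·g₁⇔ (∣ᵤ⇒∣ 1a , ∣ᵤ⇒∣ 1b))
      , D⇒∈ (Equivalence.from (α·g₂⇔ (∣ᵤ⇒∣ 1b) (∣ᵤ⇒∣ 2c)) (∣ᵤ⇒∣ 2b , ∣ᵤ⇒∣ 4a))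
      , D⇒∈ (Equivalence.from α·g₃⇔ (∣ᵤ⇒∣ 2c , ∣ᵤ⇒∣ 3d , ∣ᵤ⇒∣ 4c)) ) ,
      ( D⇒∈ (Equivalence.from θ·g₁⇔ (∣ᵤ⇒∣ 2a , ∣ᵤ⇒∣ 3a , ∣ᵤ⇒∣ 3b))
      , D⇒∈ (Equivalence.from θ·g₂⇔ (∣ᵤ⇒∣ 2d , ∣ᵤ⇒∣ 3c , ∣ᵤ⇒∣ 4b))
      , D⇒∈ (Equivalence.from θ·g₃⇔ (∣ᵤ⇒∣ 2e , ∣ᵤ⇒∣ 3e , ∣ᵤ⇒∣ 4d)) )
      where
      D⇒∈ : ∀ {x} → D x → x ∈⟨ G ⟩
      D⇒∈ {x} = divisibility⇒∈hnf a b c d e f {x}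

    closure⇔conditions : (mulα ⊚ G ⊑ G × mulθ ⊚ G ⊑ G) ⇔ Conditions′
    closure⇔conditions = mk⇔ closure⇒conditions conditions⇒closure

module Coordinates (h k : ℕ) .{{_ : NonZero k}} where
  open Q using (_+_; _*_; -_)

  ĥ k̂ ε̂ σ̂ A B : ℚ
  ĥ = ι (+ h)
  k̂ = ι (+ k)
  ε̂ = ι (ε h k)
  σ̂ = ι (+ σ h k)
  A = (+ 1) Q./ σ h k
  B = (+ 1) Q./ k

  open CubicCoordinates ĥ k̂ ε̂ σ̂ A B public

  α³ : ℚ
  α³ = ι (+ mN h k)

  σ̂A≡1 : σ̂ * A ≡ 1ℚ
  σ̂A≡1 = ι-*-inverse (σ h k)

  k̂B≡1 : k̂ * B ≡ 1ℚ
  k̂B≡1 = ι-*-inverse k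

  θK≡θ̂ : θK h k ≡ θ̂
  θK≡θ̂ = cong₃ ⟨_,_,_⟩ (/-as-ι (+ k) (σ h k))
              (trans (/-as-ι (ε h k Z.* + k) (σ h k)) (cong (_* A) (ι-* (ε h k) (+ k))))
              refl

  ⟪_⟫ : ℤ³ → K
  ⟪ u , v , w ⟫ = ((u ·K 1K) +K (v ·K αK)) +K (w ·K θK h k)

  ⟪⟫-coordinates : ∀ u v w → ⟪ u , v , w ⟫ ≡ inCoordinates (ι u) (ι v) (ι w)
  ⟪⟫-coordinates u v w =
    trans (cong (λ t → ((u ·K 1K) +K (v ·K αK)) +K (w ·K t)) θK≡θ̂)
      (cong₃ ⟨_,_,_⟩ (ring₀ (ι u) (ι v) (ι w) (c0 θ̂)) (ring₁ (ι u) (ι v) (ι w) (c1 θ̂))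
                     (ring₂ (ι u) (ι v) (ι w) (c2 θ̂)))
    where
    ring₀ : ∀ u v w t → (u * 1ℚ + v * 0ℚ) + w * t ≡ u + w * t
    ring₀ = Ring.solve-∀ ℚ-ring
    ring₁ : ∀ u v w t → (u * 0ℚ + v * 1ℚ) + w * t ≡ v + w * t
    ring₁ = Ring.solve-∀ ℚ-ring
    ring₂ : ∀ u v w t → (u * 0ℚ + v * 0ℚ) + w * t ≡ w * t
    ring₂ = Ring.solve-∀ ℚ-ring

  ⟪⟫-+ : ∀ x y → ⟪ x ⟫ +K ⟪ y ⟫ ≡ ⟪ x ⊕ y ⟫
  ⟪⟫-+ (u , v , w) (u′ , v′ , w′) = begin
    ⟪ u , v , w ⟫ +K ⟪ u′ , v′ , w′ ⟫
      ≡⟨ cong₂ _+K_ (⟪⟫-coordinates u v w) (⟪⟫-coordinates u′ v′ w′) ⟩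
    inCoordinates (ι u) (ι v) (ι w) +K inCoordinates (ι u′) (ι v′) (ι w′)
      ≡⟨ inCoordinates-+ (ι u) (ι v) (ι w) (ι u′) (ι v′) (ι w′) ⟩
    inCoordinates (ι u + ι u′) (ι v + ι v′) (ι w + ι w′)
      ≡⟨ cong₃ inCoordinates (ι-+ u u′) (ι-+ v v′) (ι-+ w w′) ⟨
    inCoordinates (ι (u Z.+ u′)) (ι (v Z.+ v′)) (ι (w Z.+ w′))
      ≡⟨ ⟪⟫-coordinates (u Z.+ u′) (v Z.+ v′) (w Z.+ w′) ⟨
    ⟪ u Z.+ u′ , v Z.+ v′ , w Z.+ w′ ⟫ ∎
    where open ≡-Reasoning

  ⟪⟫-· : ∀ n x → n ·K ⟪ x ⟫ ≡ ⟪ n ⊙ x ⟫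
  ⟪⟫-· n (u , v , w) = begin
    n ·K ⟪ u , v , w ⟫
      ≡⟨ cong (n ·K_) (⟪⟫-coordinates u v w) ⟩
    n ·K inCoordinates (ι u) (ι v) (ι w)
      ≡⟨ inCoordinates-· n (ι u) (ι v) (ι w) ⟩
    inCoordinates (ι n * ι u) (ι n * ι v) (ι n * ι w)
      ≡⟨ cong₃ inCoordinates (ι-* n u) (ι-* n v) (ι-* n w) ⟨
    inCoordinates (ι (n Z.* u)) (ι (n Z.* v)) (ι (n Z.* w))
      ≡⟨ ⟪⟫-coordinates (n Z.* u) (n Z.* v) (n Z.* w) ⟨
    ⟪ n Z.* u , n Z.* v , n Z.* w ⟫ ∎
    where open ≡-Reasoning

  ⟪⟫-injective : ∀ {x y} → ⟪ x ⟫ ≡ ⟪ y ⟫ → x ≡ y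
  ⟪⟫-injective {u , v , w} {u′ , v′ , w′} eq =
    cong₃ (λ x y z → x , y , z) (ι-injective (proj₁ ι≡)) (ι-injective (proj₁ (proj₂ ι≡)))
      (ι-injective (proj₂ (proj₂ ι≡)))
    where
    ι≡ : ι u ≡ ι u′ × ι v ≡ ι v′ × ι w ≡ ι w′
    ι≡ = inCoordinates-injective σ̂A≡1 k̂B≡1 (ι u) (ι v) (ι w) (ι u′) (ι v′) (ι w′)
      (trans (sym (⟪⟫-coordinates u v w)) (trans eq (⟪⟫-coordinates u′ v′ w′)))

  ⟪⟫-⊛ : ∀ c₀ c₁ c₂ x₀ x₁ x₂ →
    ⟪ (c₀ , c₁ , c₂) ⊛ (x₀ , x₁ , x₂) ⟫ ≡ ((x₀ ·K ⟪ c₀ ⟫) +K (x₁ ·K ⟪ c₁ ⟫)) +K (x₂ ·K ⟪ c₂ ⟫)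
  ⟪⟫-⊛ c₀ c₁ c₂ x₀ x₁ x₂ = begin
    ⟪ (x₀ ⊙ c₀ ⊕ x₁ ⊙ c₁) ⊕ x₂ ⊙ c₂ ⟫
      ≡⟨ ⟪⟫-+ (x₀ ⊙ c₀ ⊕ x₁ ⊙ c₁) (x₂ ⊙ c₂) ⟨
    ⟪ x₀ ⊙ c₀ ⊕ x₁ ⊙ c₁ ⟫ +K ⟪ x₂ ⊙ c₂ ⟫
      ≡⟨ cong (_+K ⟪ x₂ ⊙ c₂ ⟫) (⟪⟫-+ (x₀ ⊙ c₀) (x₁ ⊙ c₁)) ⟨
    (⟪ x₀ ⊙ c₀ ⟫ +K ⟪ x₁ ⊙ c₁ ⟫) +K ⟪ x₂ ⊙ c₂ ⟫
      ≡⟨ cong₃ (λ p q r → (p +K q) +K r) (⟪⟫-· x₀ c₀) (⟪⟫-· x₁ c₁) (⟪⟫-· x₂ c₂) ⟨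
    ((x₀ ·K ⟪ c₀ ⟫) +K (x₁ ·K ⟪ c₁ ⟫)) +K (x₂ ·K ⟪ c₂ ⟫) ∎
    where open ≡-Reasoning

  Span⇔⊛ : ∀ c₀ c₁ c₂ x → Span ⟪ c₀ ⟫ ⟪ c₁ ⟫ ⟪ c₂ ⟫ x ⇔ (∃ λ X → x ≡ ⟪ (c₀ , c₁ , c₂) ⊛ X ⟫)
  Span⇔⊛ c₀ c₁ c₂ x = mk⇔
    (λ (u , v , w , x≡) → (u , v , w) , trans x≡ (sym (⟪⟫-⊛ c₀ c₁ c₂ u v w)))
    (λ ((u , v , w) , x≡) → u , v , w , trans x≡ (⟪⟫-⊛ c₀ c₁ c₂ u v w))

  ⟪⟫-without-θ : ∀ u v → ⟪ u , v , + 0 ⟫ ≡ ⟨ ι u , ι v , 0ℚ ⟩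
  ⟪⟫-without-θ u v = trans (⟪⟫-coordinates u v (+ 0))
    (cong₃ ⟨_,_,_⟩ (ring₀ (ι u) (c0 θ̂)) (ring₀ (ι v) (c1 θ̂)) (ring₁ (c2 θ̂)))
    where
    ring₀ : ∀ u t → u + 0ℚ * t ≡ u
    ring₀ = Ring.solve-∀ ℚ-ring
    ring₁ : ∀ t → 0ℚ * t ≡ 0ℚ
    ring₁ = Ring.solve-∀ ℚ-ring

  0K≡⟪⟫ : 0K ≡ ⟪ + 0 , + 0 , + 0 ⟫
  0K≡⟪⟫ = sym (⟪⟫-without-θ (+ 0) (+ 0))

  αK≡⟪⟫ : αK ≡ ⟪ + 0 , + 1 , + 0 ⟫
  αK≡⟪⟫ = sym (⟪⟫-without-θ (+ 0) (+ 1))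

  θK≡⟪⟫ : θK h k ≡ ⟪ + 0 , + 0 , + 1 ⟫
  θK≡⟪⟫ = trans θK≡θ̂ (sym (trans (⟪⟫-coordinates (+ 0) (+ 0) (+ 1))
    (cong₃ ⟨_,_,_⟩ (ring (c0 θ̂)) (ring (c1 θ̂)) (ℚP.*-identityˡ (c2 θ̂)))))
    where
    ring : ∀ t → 0ℚ + 1ℚ * t ≡ t
    ring = Ring.solve-∀ ℚ-ring

  a·1K≡⟪⟫ : ∀ a → a ·K 1K ≡ ⟪ a , + 0 , + 0 ⟫
  a·1K≡⟪⟫ a = trans (cong₃ ⟨_,_,_⟩ (ℚP.*-identityʳ (ι a)) (ℚP.*-zeroʳ (ι a)) (ℚP.*-zeroʳ (ι a)))
    (sym (⟪⟫-without-θ a (+ 0)))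

  b·1K+c·αK≡⟪⟫ : ∀ b c → (b ·K 1K) +K (c ·K αK) ≡ ⟪ b , c , + 0 ⟫
  b·1K+c·αK≡⟪⟫ b c = trans (cong₃ ⟨_,_,_⟩ (ring₀ (ι b) (ι c)) (ring₁ (ι b) (ι c)) (ring₂ (ι b) (ι c)))
    (sym (⟪⟫-without-θ b c))
    where
    ring₀ : ∀ b c → b * 1ℚ + c * 0ℚ ≡ b
    ring₀ = Ring.solve-∀ ℚ-ring
    ring₁ : ∀ b c → b * 0ℚ + c * 1ℚ ≡ c
    ring₁ = Ring.solve-∀ ℚ-ring
    ring₂ : ∀ b c → b * 0ℚ + c * 0ℚ ≡ 0ℚ
    ring₂ = Ring.solve-∀ ℚ-ring

  Mod⇔∈hnf : ∀ a b c d e f x →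
    Mod h k a b c d e f x ⇔ (∃ λ X → x ≡ ⟪ hnf a b c d e f ⊛ X ⟫)
  Mod⇔∈hnf a b c d e f x =
    subst (λ P → P x ⇔ (∃ λ X → x ≡ ⟪ hnf a b c d e f ⊛ X ⟫)) (sym generators≡)
      (Span⇔⊛ (a , + 0 , + 0) (b , c , + 0) (d , e , f) x)
    where
    generators≡ : Mod h k a b c d e f ≡ Span ⟪ a , + 0 , + 0 ⟫ ⟪ b , c , + 0 ⟫ ⟪ d , e , f ⟫
    generators≡ = cong₂ (λ g₁ g₂ → Span g₁ g₂ ⟪ d , e , f ⟫) (a·1K≡⟪⟫ a) (b·1K+c·αK≡⟪⟫ b c)

  mulK-⟪⟫ : ∀ z c₀ c₁ c₂ →
    mulK h k z 1K ≡ ⟪ c₀ ⟫ → mulK h k z αK ≡ ⟪ c₁ ⟫ → mulK h k z (θK h k) ≡ ⟪ c₂ ⟫ →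
    ∀ x → mulK h k z ⟪ x ⟫ ≡ ⟪ (c₀ , c₁ , c₂) ⊛ x ⟫
  mulK-⟪⟫ z c₀ c₁ c₂ z1≡ zα≡ zθ≡ (u , v , w) = begin
    mulK h k z (((u ·K 1K) +K (v ·K αK)) +K (w ·K θK h k))
      ≡⟨ mulQ-distribˡ α³ z _ _ ⟩
    mulK h k z ((u ·K 1K) +K (v ·K αK)) +K mulK h k z (w ·K θK h k)
      ≡⟨ cong (_+K mulK h k z (w ·K θK h k)) (mulQ-distribˡ α³ z _ _) ⟩
    (mulK h k z (u ·K 1K) +K mulK h k z (v ·K αK)) +K mulK h k z (w ·K θK h k)
      ≡⟨ cong₃ (λ p q r → (p +K q) +K r)
           (mulQ-·ʳ α³ u z 1K) (mulQ-·ʳ α³ v z αK) (mulQ-·ʳ α³ w z (θK h k)) ⟩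
    ((u ·K mulK h k z 1K) +K (v ·K mulK h k z αK)) +K (w ·K mulK h k z (θK h k))
      ≡⟨ cong₃ (λ p q r → ((u ·K p) +K (v ·K q)) +K (w ·K r)) z1≡ zα≡ zθ≡ ⟩
    ((u ·K ⟪ c₀ ⟫) +K (v ·K ⟪ c₁ ⟫)) +K (w ·K ⟪ c₂ ⟫)
      ≡⟨ ⟪⟫-⊛ c₀ c₁ c₂ u v w ⟨
    ⟪ (c₀ , c₁ , c₂) ⊛ (u , v , w) ⟫ ∎
    where open ≡-Reasoning

  module Multiplication (I : Integrality h k) where
    open Integrality I

    ε̂²≡1 : ε̂ * ε̂ ≡ 1ℚ
    ε̂²≡1 = trans (sym (ι-* (ε h k) (ε h k))) (cong ι ε²≡1)

    α³≡m̂ : α³ ≡ m̂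
    α³≡m̂ = trans (cong ι (+mN h k)) (trans (ι-* (+ h Z.* + k) (+ k)) (cong (_* k̂) (ι-* (+ h) (+ k))))

    mulK≡mulQ : ∀ x y → mulK h k x y ≡ mulQ m̂ x y
    mulK≡mulQ x y = cong (λ m → mulQ m x y) α³≡m̂

    ι-pZ : ι (pZ h k) ≡ p̂
    ι-pZ = trans (ι-/ℕ-exact _ (σ h k) A σ∣p σ̂A≡1) (cong (_* A) (ι-pNumerator (+ h) (+ k) (ε h k)))

    ι-qZ : ι (qZ h k) ≡ q̂
    ι-qZ = trans (ι-/ℕ-exact _ (σ h k) A σ∣q σ̂A≡1) (cong (_* A) (ι-qNumerator (+ h) (+ k) (ε h k)))

    ι-tZ : ι (tZ h k) ≡ t̂
    ι-tZ = trans (ι-/ℕ-exact _ (σ h k) A σ∣t σ̂A≡1) (cong (_* A) (ι-tNumerator (+ h) (+ k) (ε h k)))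

    σ̂²A²≡1 : ι (+ (σ h k N.* σ h k)) * (A * A) ≡ 1ℚ
    σ̂²A²≡1 = begin
      ι (+ (σ h k N.* σ h k)) * (A * A)  ≡⟨ cong (λ x → ι x * (A * A)) (ℤP.pos-* (σ h k) (σ h k)) ⟩
      ι (+ σ h k Z.* + σ h k) * (A * A)  ≡⟨ cong (_* (A * A)) (ι-* (+ σ h k) (+ σ h k)) ⟩
      σ̂ * σ̂ * (A * A)                    ≡⟨ ring σ̂ A ⟩
      (σ̂ * A) * (σ̂ * A)                  ≡⟨ cong₂ _*_ σ̂A≡1 σ̂A≡1 ⟩
      1ℚ * 1ℚ                            ≡⟨ ℚP.*-identityˡ 1ℚ ⟩
      1ℚ                                 ∎
      where
      open ≡-Reasoning
      ring : ∀ s a → s * s * (a * a) ≡ (s * a) * (s * a)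
      ring = Ring.solve-∀ ℚ-ring

    ι-rZ : ι (rZ h k) ≡ r̂
    ι-rZ = trans (ι-/ℕ-exact _ (σ h k N.* σ h k) (A * A) σ²∣r σ̂²A²≡1)
      (cong (_* (A * A)) (ι-rNumerator (+ h) (+ k) (ε h k)))

    ι-sZ : ι (sZ h k) ≡ ŝ
    ι-sZ = trans (ι-/ℕ-exact _ (σ h k N.* σ h k) (A * A) σ²∣s σ̂²A²≡1)
      (cong (_* (A * A)) (ι-sNumerator (+ h) (+ k) (ε h k)))

    private
      ≡⟪⟫ : ∀ {x U V W} u v w → ι u ≡ U → ι v ≡ V → ι w ≡ W →
        x ≡ inCoordinates U V W → x ≡ ⟪ u , v , w ⟫
      ≡⟪⟫ u v w ιu ιv ιw x≡ =
        trans x≡ (sym (trans (⟪⟫-coordinates u v w) (cong₃ inCoordinates ιu ιv ιw)))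

      ι-k² : ι (+ k Z.* + k) ≡ k̂ * k̂
      ι-k² = ι-* (+ k) (+ k)

    open StructureMatrices (+ σ h k) (ε h k) (+ k) (pZ h k) (qZ h k) (rZ h k) (sZ h k) (tZ h k) public

    α² : mulK h k αK αK ≡ ⟪ α²-coords ⟫
    α² = ≡⟪⟫ (Z.- (+ k Z.* + k)) (Z.- (ε h k Z.* (+ k Z.* + k))) (+ σ h k Z.* + k)
      (trans (ι-neg (+ k Z.* + k)) (cong -_ ι-k²))
      (trans (ι-neg (ε h k Z.* (+ k Z.* + k)))
        (cong -_ (trans (ι-* (ε h k) (+ k Z.* + k)) (cong (ε̂ *_) ι-k²))))
      (ι-* (+ σ h k) (+ k))
      (trans (mulK≡mulQ αK αK) (α̂α̂ σ̂A≡1 k̂B≡1 ε̂²≡1))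

    αθ : mulK h k αK (θK h k) ≡ ⟪ αθ-coords ⟫
    αθ = ≡⟪⟫ (pZ h k) (qZ h k) (ε h k Z.* (+ k Z.* + k)) ι-pZ ι-qZ
      (trans (ι-* (ε h k) (+ k Z.* + k)) (cong (ε̂ *_) ι-k²))
      (trans (mulK≡mulQ αK (θK h k)) (trans (cong (mulQ m̂ α̂) θK≡θ̂) (α̂θ̂ σ̂A≡1 k̂B≡1 ε̂²≡1)))

    θ² : mulK h k (θK h k) (θK h k) ≡ ⟪ θ²-coords ⟫
    θ² = ≡⟪⟫ (Z.- (+ k Z.* + k Z.* rZ h k)) (sZ h k) (tZ h k)
      (trans (ι-neg (+ k Z.* + k Z.* rZ h k))
        (cong -_ (trans (ι-* (+ k Z.* + k) (rZ h k)) (cong₂ _*_ ι-k² ι-rZ))))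
      ι-sZ ι-tZ
      (trans (mulK≡mulQ (θK h k) (θK h k))
        (trans (cong₂ (mulQ m̂) θK≡θ̂ θK≡θ̂) (θ̂θ̂ σ̂A≡1 k̂B≡1 ε̂²≡1)))

    αK·⟪⟫ : ∀ x → mulK h k αK ⟪ x ⟫ ≡ ⟪ mulα ⊛ x ⟫
    αK·⟪⟫ = mulK-⟪⟫ αK (+ 0 , + 1 , + 0) α²-coords αθ-coords
      (trans (mulQ-comm α³ αK 1K) (trans (mulQ-identityˡ α³ αK) αK≡⟪⟫)) α² αθ

    θK·⟪⟫ : ∀ x → mulK h k (θK h k) ⟪ x ⟫ ≡ ⟪ mulθ ⊛ x ⟫
    θK·⟪⟫ = mulK-⟪⟫ (θK h k) (+ 0 , + 0 , + 1) αθ-coords θ²-coords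
      (trans (mulQ-comm α³ (θK h k) 1K) (trans (mulQ-identityˡ α³ (θK h k)) θK≡⟪⟫))
      (trans (mulQ-comm α³ (θK h k) αK) αθ) θ²

    mulK-⟪⟫⟪⟫ : ∀ u x → mulK h k ⟪ u ⟫ ⟪ x ⟫ ≡ ⟪ (x , mulα ⊛ x , mulθ ⊛ x) ⊛ u ⟫
    mulK-⟪⟫⟪⟫ u x = trans (mulQ-comm α³ ⟪ u ⟫ ⟪ x ⟫) (mulK-⟪⟫ ⟪ x ⟫ x (mulα ⊛ x) (mulθ ⊛ x)
      (trans (mulQ-comm α³ ⟪ x ⟫ 1K) (mulQ-identityˡ α³ ⟪ x ⟫))
      (trans (mulQ-comm α³ ⟪ x ⟫ αK) (αK·⟪⟫ x))
      (trans (mulQ-comm α³ ⟪ x ⟫ (θK h k)) (θK·⟪⟫ x)) u)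

    αK∈𝒪 : OK h k αK
    αK∈𝒪 = + 0 , + 1 , + 0 , αK≡⟪⟫

    θK∈𝒪 : OK h k (θK h k)
    θK∈𝒪 = + 0 , + 0 , + 1 , θK≡⟪⟫

    module _ (a b c d e f : ℤ) where
      private
        G : Mat
        G = hnf a b c d e f
        M : K → Set
        M = Mod h k a b c d e f

      M⇒⟪⟫ : ∀ x → M x → Σ ℤ³ λ y → x ≡ ⟪ y ⟫ × y ∈⟨ G ⟩
      M⇒⟪⟫ x m = G ⊛ proj₁ X,x≡ , proj₂ X,x≡ , proj₁ X,x≡ , refl
        where
        X,x≡ : ∃ λ X → x ≡ ⟪ G ⊛ X ⟫
        X,x≡ = Equivalence.to (Mod⇔∈hnf a b c d e f x) m

      ⟪⟫⇒M : ∀ x y → x ≡ ⟪ y ⟫ → y ∈⟨ G ⟩ → M x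
      ⟪⟫⇒M x y x≡ (X , refl) = Equivalence.from (Mod⇔∈hnf a b c d e f x) (X , x≡)

      ⟪⟫∈M⇒ : ∀ y → M ⟪ y ⟫ → y ∈⟨ G ⟩
      ⟪⟫∈M⇒ y m = in-span (M⇒⟪⟫ ⟪ y ⟫ m)
        where
        in-span : Σ ℤ³ (λ y′ → ⟪ y ⟫ ≡ ⟪ y′ ⟫ × y′ ∈⟨ G ⟩) → y ∈⟨ G ⟩
        in-span (y′ , ⟪y⟫≡⟪y′⟫ , y′∈) = subst (_∈⟨ G ⟩) (sym (⟪⟫-injective ⟪y⟫≡⟪y′⟫)) y′∈

      closed-under : ∀ ω N → OK h k ω → (∀ x → mulK h k ω ⟪ x ⟫ ≡ ⟪ N ⊛ x ⟫) → IsIdeal h k M →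
        N ⊚ G ⊑ G
      closed-under ω N ω∈𝒪 ω-⟪⟫ (_ , _ , _ , mul∈) =
        column (proj₁ (⊑-refl G)) , column (proj₁ (proj₂ (⊑-refl G))) ,
        column (proj₂ (proj₂ (⊑-refl G)))
        where
        column : ∀ {g} → g ∈⟨ G ⟩ → N ⊛ g ∈⟨ G ⟩
        column {g} g∈ = ⟪⟫∈M⇒ (N ⊛ g) (subst M (ω-⟪⟫ g) (mul∈ ω ⟪ g ⟫ ω∈𝒪 (⟪⟫⇒M ⟪ g ⟫ g refl g∈)))

      IsIdeal⇒ : IsIdeal h k M → (mulα ⊚ G ⊑ G × mulθ ⊚ G ⊑ G)
      IsIdeal⇒ ideal =
        closed-under αK mulα αK∈𝒪 αK·⟪⟫ ideal , closed-under (θK h k) mulθ θK∈𝒪 θK·⟪⟫ ideal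

      ⊆𝒪 : ∀ x → M x → OK h k x
      ⊆𝒪 x m = in-𝒪 (M⇒⟪⟫ x m)
        where
        in-𝒪 : Σ ℤ³ (λ y → x ≡ ⟪ y ⟫ × y ∈⟨ G ⟩) → OK h k x
        in-𝒪 ((u , v , w) , x≡ , _) = u , v , w , x≡

      0∈M : M 0K
      0∈M = ⟪⟫⇒M 0K (+ 0 , + 0 , + 0) 0K≡⟪⟫ (0∈⟨⟩ G)

      +-closed : ∀ x x′ → M x → M x′ → M (x +K x′)
      +-closed x x′ m m′ = sum (M⇒⟪⟫ x m) (M⇒⟪⟫ x′ m′)
        where
        sum : Σ ℤ³ (λ y → x ≡ ⟪ y ⟫ × y ∈⟨ G ⟩) → Σ ℤ³ (λ y → x′ ≡ ⟪ y ⟫ × y ∈⟨ G ⟩) → M (x +K x′)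
        sum (y , x≡ , y∈) (y′ , x′≡ , y′∈) =
          ⟪⟫⇒M (x +K x′) (y ⊕ y′) (trans (cong₂ _+K_ x≡ x′≡) (⟪⟫-+ y y′)) (⊕-∈⟨⟩ y∈ y′∈)

      mul-closed : mulα ⊚ G ⊑ G → mulθ ⊚ G ⊑ G → ∀ ω x → OK h k ω → M x → M (mulK h k ω x)
      mul-closed α-closed θ-closed ω x (u , v , w , ω≡) m = product (M⇒⟪⟫ x m)
        where
        product : Σ ℤ³ (λ y → x ≡ ⟪ y ⟫ × y ∈⟨ G ⟩) → M (mulK h k ω x)
        product (y , x≡ , y∈) = ⟪⟫⇒M (mulK h k ω x) ((y , mulα ⊛ y , mulθ ⊛ y) ⊛ (u , v , w))
          (trans (cong₂ (mulK h k) ω≡ x≡) (mulK-⟪⟫⟪⟫ (u , v , w) y))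
          (⊛-∈⟨⟩ (y∈ , ⊛-preserves-∈⟨⟩ α-closed y∈ , ⊛-preserves-∈⟨⟩ θ-closed y∈) (u , v , w))

      IsIdeal⇔ : IsIdeal h k M ⇔ (mulα ⊚ G ⊑ G × mulθ ⊚ G ⊑ G)
      IsIdeal⇔ = mk⇔ IsIdeal⇒ λ (α-closed , θ-closed) →
        ⊆𝒪 , 0∈M , +-closed , mul-closed α-closed θ-closed

mainTheorem2 : (h k : ℕ) → .{{_ : NonZero k}} →
  0 N.< h → k N.< h → SquareFree h → SquareFree k → Coprime h k →
  (a b c d e f : ℤ) →
  + 0 Z.< a → + 0 Z.< c → + 0 Z.< f →
  + 0 Z.≤ b → b Z.< a → + 0 Z.≤ d → d Z.< a → + 0 Z.≤ e → e Z.< c →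
  IsIdeal h k (Mod h k a b c d e f) ⇔ Conditions h k a b c d e f
mainTheorem2 h k _ _ _ _ _ a b c d e f 0<a 0<c 0<f _ _ _ _ _ _ =
  closure⇔conditions a b c d e f ⇔-∘ IsIdeal⇔ a b c d e f
  where
  open Coordinates h k
  open Multiplication (integrality h k)
  instance
    a≢0 : Z.NonZero a
    a≢0 = Z.>-nonZero 0<a
    c≢0 : Z.NonZero c
    c≢0 = Z.>-nonZero 0<c
    f≢0 : Z.NonZero f
    f≢0 = Z.>-nonZero 0<f
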